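{- Let $q$ be a prime power and $n\ge 1$. (i) $g_{q-1}$ is $1$st order sum-free on $\mathbb F_{q^n}$. (ii) If $n\ge 2$, then $g_{q-1}$ is $2$nd order sum-free on $\mathbb F_{q^n}$ if and only if $n$ is odd.
   Context: $g_{q-1}:\mathbb F_{q^n}\to\mathbb F_{q^n}$ is defined by $g_{q-1}(x)=1/x^{q-1}$ for $x\ne 0$ and $g_{q-1}(0)=0$. A function $f:\mathbb F_{q^n}\to\mathbb F_{q^n}$ is $k$th order sum-free if $\sum_{x\in A}f(x)\ne0$ for every $k$-dimensional $\mathbb F_q$-affine subspace $A$ of $\mathbb F_{q^n}$. -}

module Defs where

open import Level using (0ℓ)
open import Data.Nat as ℕ using (ℕ; zero; suc; _≤_; _%_)
open import Data.Nat.Primality using (Prime)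
open import Data.Product using (Σ; ∃; ∃-syntax; _×_; _,_)
open import Data.List as List using (List; []; _∷_; foldr; filter; concatMap; length)
open import Data.List.Membership.Propositional using (_∈_)
open import Data.List.Relation.Unary.Unique.Propositional using (Unique)
open import Data.Vec as Vec using (Vec; []; _∷_)
open import Data.Vec.Relation.Unary.All as VAll using (All)
open import Relation.Nullary using (¬_; Dec; yes; no)
open import Relation.Binary.PropositionalEquality using (_≡_; _≢_)
open import Algebra.Structures using (IsCommutativeRing)

IsPrimePower : ℕ → Set
IsPrimePower q = ∃[ p ] ∃[ m ] (Prime p × 1 ≤ m × q ≡ p ℕ.^ m)

Odd : ℕ → Set
Odd n = n % 2 ≡ 1

record FiniteField : Set₁ where
  infixl 6 _+_
  infixl 7 _*_
  field
    Carrier  : Set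
    _+_ _*_  : Carrier → Carrier → Carrier
    -_       : Carrier → Carrier
    0# 1#    : Carrier
    isCommutativeRing : IsCommutativeRing _≡_ _+_ _*_ -_ 0# 1#
    0≢1      : 0# ≢ 1#
    _⁻¹      : Carrier → Carrier
    inverseʳ : ∀ x → x ≢ 0# → x * (x ⁻¹) ≡ 1#
    _≟_      : (x y : Carrier) → Dec (x ≡ y)
    elements : List Carrier
    complete : ∀ x → x ∈ elements
    unique   : Unique elements

  size : ℕ
  size = length elements

  _^_ : Carrier → ℕ → Carrier
  x ^ zero  = 1#
  x ^ suc k = x * (x ^ k)

  sum : List Carrier → Carrier
  sum = foldr _+_ 0#

  InSub : ℕ → Carrier → Set
  InSub q x = x ^ q ≡ x

  subElements : ℕ → List Carrier
  subElements q = filter (λ x → (x ^ q) ≟ x) elements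

  vecs : (k : ℕ) → List Carrier → List (Vec Carrier k)
  vecs zero      xs = [] ∷ []
  vecs (suc k)   xs = concatMap (λ x → List.map (x ∷_) (vecs k xs)) xs

  lin : ∀ {k} → Vec Carrier k → Vec Carrier k → Carrier
  lin []       []       = 0#
  lin (c ∷ cs) (b ∷ bs) = c * b + lin cs bs

  LinIndep : ℕ → ∀ {k} → Vec Carrier k → Set
  LinIndep q {k} bs = (cs : Vec Carrier k) → All (InSub q) cs →
                      lin cs bs ≡ 0# → All (_≡ 0#) cs

  -- sum of f over the k-dimensional F_q-affine subspace a + span_{F_q}(b_1..b_k)
  -- (the parametrisation c ↦ a + Σ c_i b_i is a bijection onto it)
  affineSum : (q : ℕ) → (Carrier → Carrier) → ∀ {k} → Carrier → Vec Carrier k → Carrier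
  affineSum q f {k} a bs = sum (List.map (λ cs → f (a + lin cs bs)) (vecs k (subElements q)))

  SumFree : (q k : ℕ) → (Carrier → Carrier) → Set
  SumFree q k f = (a : Carrier) (bs : Vec Carrier k) → LinIndep q bs →
                  affineSum q f a bs ≢ 0#

  g : ℕ → Carrier → Carrier
  g q x with x ≟ 0#
  ... | yes _ = 0#
  ... | no  _ = (x ^ (q ℕ.∸ 1)) ⁻¹

module Submission where

-- Let K = F_q inside F = F_{q^n} (the roots of x^q = x) and h(t) = Σ_{c∈K} g(t + c).
-- The q-th power map is additive and fixes K, and s ↦ Σ_{c∈K} (s + c)^{q-1} + 1 is a polynomial
-- of degree < q vanishing on the q points of K, hence identically zero.  It follows that
-- h(t) = -1 for t ∈ K and h(t) = g(t^q - t) otherwise, so h never vanishes.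
-- (i)  The line a + Kb sums to g(b) h(a/b) ≠ 0.
-- (ii) The plane a + Kb₁ + Kb₂ sums to g(b₂) J(α, β), where α = a/b₂, β = b₁/b₂ ∉ K and
--      J(α, β) = Σ_{c∈K} h(α + cβ) = g(B) h(A/B) - #{c ∈ K | α + cβ ∈ K}, A = α^q - α, B = β^q - β.
--      So J = 0 forces the line α + Kβ to meet K and g(B) = -1, i.e. B^q = -B, i.e. β^{q²} = β.
--      For n odd this puts β in K, a contradiction; for n even any u ∈ F_{q²} ∖ K gives J(0, u) = 0.

open import Defs
open import Level using (0ℓ)
open import Algebra.Bundles using (CommutativeRing; CommutativeSemigroup)
open import Algebra.Core using (Op₂)
open import Algebra.Structures using (IsCommutativeMonoid)
open import Algebra.Solver.Ring.AlmostCommutativeRing using (fromCommutativeRing; _-Raw-AlmostCommutative⟶_)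
open import Data.Fin.Patterns using (0F)
import Data.Fin.Properties as Fin
open import Data.Integer as ℤ using (ℤ; -[1+_]; _⊖_; _◃_; sign; ∣_∣)
import Data.Integer.Properties as ℤ
open import Data.List as List using (List; []; _∷_; length; filter; map; foldr; _++_)
import Data.List.Properties as List
open import Data.List.Membership.Propositional using (_∈_; _∉_; lose; find)
import Data.List.Membership.Propositional.Properties as ∈
open import Data.List.Membership.Propositional.Properties.WithK using (unique∧set⇒bag)
open import Data.List.Relation.Binary.BagAndSetEquality using (∼bag⇒↭)
open import Data.List.Relation.Binary.Permutation.Propositional using (_↭_; ↭⇒↭ₛ′)
import Data.List.Relation.Binary.Permutation.Propositional.Properties as ↭
import Data.List.Relation.Binary.Permutation.Setoid.Properties as Setoid↭
open import Data.List.Relation.Binary.Subset.Propositional using (_⊆_)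
open import Data.List.Relation.Unary.All as All using (All; []; _∷_)
import Data.List.Relation.Unary.All.Properties as All
open import Data.List.Relation.Unary.Any as Any using (here; there)
open import Data.List.Relation.Unary.AllPairs using ([]; _∷_)
open import Data.List.Relation.Unary.Unique.Propositional using (Unique)
import Data.List.Relation.Unary.Unique.Propositional.Properties as Unique
open import Data.Maybe as Maybe using (Maybe)
open import Data.Nat as ℕ using (ℕ; zero; suc; _≤_; _<_; z≤n; s≤s)
import Data.Nat.Properties as ℕ
open import Data.Nat.Combinatorics using (_C_; nC1≡n; nCn≡1; nCk+nC[k+1]≡[n+1]C[k+1])
open import Data.Nat.DivMod using (_%_; _/_; m≡m%n+[m/n]*n; m%n<n)
open import Data.Nat.Divisibility using (_∣_; divides; ∣⇒≤)
open import Data.Nat.Primality using (Prime; euclidsLemma; prime⇒nonZero; prime⇒nonTrivial)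
open import Data.Nat.Tactic.RingSolver using (solve-∀)
open import Data.Product using (Σ-syntax; ∃-syntax; _×_; _,_; proj₂)
open import Data.Sign as Sign using (Sign)
open import Data.Sum using (_⊎_; inj₁; inj₂; [_,_]′)
open import Data.Vec as Vec using (Vec; []; _∷_; _∷ʳ_)
open import Data.Vec.Functional using (tail; init; last)
open import Data.Vec.Relation.Unary.All using ([]; _∷_)
open import Function.Base using (_∘_; id)
open import Function.Bundles using (_⇔_; mk⇔)
open import Relation.Binary.Definitions using (DecidableEquality)
open import Relation.Binary.PropositionalEquality as ≡
  using (_≡_; _≢_; refl; sym; trans; cong; cong₂; subst; subst₂; module ≡-Reasoning)
open import Relation.Nullary using (¬_; Dec; yes; no; ¬?; contradiction)
open import Relation.Nullary.Decidable using (dec⇒maybe)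
open import Relation.Unary using (Pred; Decidable)
open import Relation.Unary.Properties using (∁?)

-- Normal forms of the ring solver only compute if coefficient arithmetic does, so an abstract
-- commutative ring R is given coefficients in ℤ, interpreted by n ↦ n · 1#.
module IntegerCoefficientRingSolver {c ℓ} (R : CommutativeRing c ℓ) where

  open CommutativeRing R renaming (refl to ≈-refl; sym to ≈-sym; trans to ≈-trans)
  open import Algebra.Properties.Ring ring using (-1*x≈-x; -‿involutive; -0#≈0#; -‿distribˡ-*; -‿+-comm; +-cancelʳ)
  open import Algebra.Properties.Group +-group using (//-rightDividesˡ)
  open import Algebra.Properties.CommutativeSemigroup *-commutativeSemigroup using (interchange)
  open import Algebra.Properties.CommutativeSemigroup +-commutativeSemigroup using (x∙yz≈y∙xz)
  open import Algebra.Properties.Monoid.Mult +-monoid using (×-homo-+) renaming (_×_ to _·_)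
  open import Algebra.Properties.Semiring.Mult semiring using (×1-homo-*)
  open import Relation.Binary.Reasoning.Setoid setoid

  private
    fromSign : Sign → Carrier
    fromSign Sign.+ = 1#
    fromSign Sign.- = - 1#

    fromℤ : ℤ → Carrier
    fromℤ (ℤ.+ n)  = n · 1#
    fromℤ -[1+ n ] = - (suc n · 1#)

    fromSign-homo-* : ∀ s t → fromSign (s Sign.* t) ≈ fromSign s * fromSign t
    fromSign-homo-* Sign.+ t      = ≈-sym (*-identityˡ _)
    fromSign-homo-* Sign.- Sign.+ = ≈-sym (*-identityʳ _)
    fromSign-homo-* Sign.- Sign.- = ≈-sym (≈-trans (-1*x≈-x (- 1#)) (-‿involutive 1#))

    fromℤ-◃ : ∀ s n → fromℤ (s ◃ n) ≈ fromSign s * (n · 1#)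
    fromℤ-◃ s      zero    = ≈-sym (zeroʳ _)
    fromℤ-◃ Sign.+ (suc n) = ≈-sym (*-identityˡ _)
    fromℤ-◃ Sign.- (suc n) = ≈-trans (-‿cong (≈-sym (*-identityˡ _))) (-‿distribˡ-* _ _)

    fromℤ-signAbs : ∀ i → fromℤ i ≈ fromSign (sign i) * (∣ i ∣ · 1#)
    fromℤ-signAbs i = ≈-trans (reflexive (≡.cong fromℤ (≡.sym (ℤ.◃-inverse i)))) (fromℤ-◃ (sign i) ∣ i ∣)

    fromℤ-homo-* : ∀ i j → fromℤ (i ℤ.* j) ≈ fromℤ i * fromℤ j
    fromℤ-homo-* i j = begin
      fromℤ (i ℤ.* j)
        ≈⟨ fromℤ-◃ (sign i Sign.* sign j) (∣ i ∣ ℕ.* ∣ j ∣) ⟩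
      fromSign (sign i Sign.* sign j) * ((∣ i ∣ ℕ.* ∣ j ∣) · 1#)
        ≈⟨ *-cong (fromSign-homo-* (sign i) (sign j)) (×1-homo-* ∣ i ∣ ∣ j ∣) ⟩
      (fromSign (sign i) * fromSign (sign j)) * ((∣ i ∣ · 1#) * (∣ j ∣ · 1#))
        ≈⟨ interchange _ _ _ _ ⟩
      (fromSign (sign i) * (∣ i ∣ · 1#)) * (fromSign (sign j) * (∣ j ∣ · 1#))
        ≈⟨ *-cong (fromℤ-signAbs i) (fromℤ-signAbs j) ⟨
      fromℤ i * fromℤ j ∎

    fromℤ-⊖-+ : ∀ m n → fromℤ (m ⊖ n) + n · 1# ≈ m · 1#
    fromℤ-⊖-+ m       zero    = +-identityʳ _
    fromℤ-⊖-+ zero    (suc n) = -‿inverseˡ _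
    fromℤ-⊖-+ (suc m) (suc n) = begin
      fromℤ (suc m ⊖ suc n) + (1# + n · 1#)  ≡⟨ ≡.cong (λ i → fromℤ i + _) (ℤ.[1+m]⊖[1+n]≡m⊖n m n) ⟩
      fromℤ (m ⊖ n) + (1# + n · 1#)          ≈⟨ x∙yz≈y∙xz _ 1# _ ⟩
      1# + (fromℤ (m ⊖ n) + n · 1#)          ≈⟨ +-congˡ (fromℤ-⊖-+ m n) ⟩
      1# + m · 1#                            ∎

    fromℤ-⊖ : ∀ m n → fromℤ (m ⊖ n) ≈ m · 1# - n · 1#
    fromℤ-⊖ m n = +-cancelʳ (n · 1#) _ _
      (≈-trans (fromℤ-⊖-+ m n) (≈-sym (//-rightDividesˡ (n · 1#) (m · 1#))))

    fromℤ-homo-+ : ∀ i j → fromℤ (i ℤ.+ j) ≈ fromℤ i + fromℤ j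
    fromℤ-homo-+ (ℤ.+ m)  (ℤ.+ n)  = ×-homo-+ 1# m n
    fromℤ-homo-+ (ℤ.+ m)  -[1+ n ] = fromℤ-⊖ m (suc n)
    fromℤ-homo-+ -[1+ m ] (ℤ.+ n)  = ≈-trans (fromℤ-⊖ n (suc m)) (+-comm _ _)
    fromℤ-homo-+ -[1+ m ] -[1+ n ] = begin
      - (suc (suc (m ℕ.+ n)) · 1#)     ≡⟨ ≡.cong (λ k → - (suc k · 1#)) (ℕ.+-suc m n) ⟨
      - ((suc m ℕ.+ suc n) · 1#)       ≈⟨ -‿cong (×-homo-+ 1# (suc m) (suc n)) ⟩
      - (suc m · 1# + suc n · 1#)      ≈⟨ -‿+-comm _ _ ⟨
      - (suc m · 1#) + - (suc n · 1#)  ∎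

    fromℤ-homo-- : ∀ i → fromℤ (ℤ.- i) ≈ - fromℤ i
    fromℤ-homo-- -[1+ n ]      = ≈-sym (-‿involutive _)
    fromℤ-homo-- (ℤ.+ zero)    = ≈-sym -0#≈0#
    fromℤ-homo-- (ℤ.+ suc n)   = ≈-refl

    fromℤ-homomorphism : ℤ.+-*-rawRing -Raw-AlmostCommutative⟶ fromCommutativeRing R
    fromℤ-homomorphism = record
      { ⟦_⟧    = fromℤ
      ; +-homo = fromℤ-homo-+
      ; *-homo = fromℤ-homo-*
      ; -‿homo = fromℤ-homo--
      ; 0-homo = ≈-refl
      ; 1-homo = +-identityʳ 1#
      }

    fromℤ-≟ : ∀ i j → Maybe (fromℤ i ≈ fromℤ j)
    fromℤ-≟ i j = Maybe.map (reflexive ∘ ≡.cong fromℤ) (dec⇒maybe (i ℤ.≟ j))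

  open import Algebra.Solver.Ring ℤ.+-*-rawRing (fromCommutativeRing R) fromℤ-homomorphism fromℤ-≟ public
    using (solve; _:=_; _:+_; _:*_; _:-_; :-_)

module _ {A : Set} where

  map-inverse-↭ : ∀ {xs} (f g : A → A) → Unique xs →
                  (∀ {x} → x ∈ xs → f x ∈ xs) → (∀ {x} → x ∈ xs → g x ∈ xs) →
                  (∀ x → f (g x) ≡ x) → (∀ x → g (f x) ≡ x) → map f xs ↭ xs
  map-inverse-↭ {xs} f g xs! f∈ g∈ fg gf =
    ∼bag⇒↭ (unique∧set⇒bag (Unique.map⁺ f-injective xs!) xs! (mk⇔ to from))
    where
    f-injective : ∀ {x y} → f x ≡ f y → x ≡ y
    f-injective {x} {y} eq = trans (sym (gf x)) (trans (cong g eq) (gf y))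
    to : ∀ {x} → x ∈ map f xs → x ∈ xs
    to x∈ with ∈.∈-map⁻ f x∈
    ... | y , y∈xs , refl = f∈ y∈xs
    from : ∀ {x} → x ∈ xs → x ∈ map f xs
    from {x} x∈xs = subst (_∈ map f xs) (fg x) (∈.∈-map⁺ f (g∈ x∈xs))

  ∈-++-∷⁻ : ∀ {x y : A} l {r : List A} → y ∈ l ++ x ∷ r → y ≢ x → y ∈ l ++ r
  ∈-++-∷⁻ []      (here y≡x)  y≢x = contradiction y≡x y≢x
  ∈-++-∷⁻ []      (there y∈r) _   = y∈r
  ∈-++-∷⁻ (z ∷ l) (here y≡z)  _   = here y≡z
  ∈-++-∷⁻ (z ∷ l) (there y∈)  y≢x = there (∈-++-∷⁻ l y∈ y≢x)

  Unique∧⊆⇒length≤ : ∀ {xs ys : List A} → Unique xs → xs ⊆ ys → length xs ≤ length ys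
  Unique∧⊆⇒length≤ {[]}     _              _     = z≤n
  Unique∧⊆⇒length≤ {x ∷ xs} (x∉xs ∷ xs!) xs⊆ys with ∈.∈-∃++ (xs⊆ys (here refl))
  ... | l , r , refl = begin
    suc (length xs)              ≤⟨ s≤s (Unique∧⊆⇒length≤ xs! xs⊆l++r) ⟩
    suc (length (l ++ r))        ≡⟨ cong suc (List.length-++ l) ⟩
    suc (length l ℕ.+ length r)  ≡⟨ ℕ.+-suc (length l) (length r) ⟨
    length l ℕ.+ length (x ∷ r)  ≡⟨ List.length-++ l ⟨
    length (l ++ x ∷ r)          ∎
    where
    open ℕ.≤-Reasoning
    xs⊆l++r : xs ⊆ l ++ r
    xs⊆l++r y∈xs = ∈-++-∷⁻ l (xs⊆ys (there y∈xs)) λ y≡x → All.lookup x∉xs y∈xs (sym y≡x)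

  module _ (_≟_ : DecidableEquality A) where

    open import Data.List.Membership.DecPropositional _≟_ using (_∈?_)

    length<⇒∃∈∧∉ : ∀ {xs ys : List A} → Unique xs → length ys < length xs → ∃[ x ] x ∈ xs × x ∉ ys
    length<⇒∃∈∧∉ {xs} {ys} xs! ys<xs with All.all? (_∈? ys) xs
    ... | yes xs⊆ys = contradiction (Unique∧⊆⇒length≤ xs! (All.lookup xs⊆ys)) (ℕ.<⇒≱ ys<xs)
    ... | no xs⊈ys  = find (All.¬All⇒Any¬ (_∈? ys) xs xs⊈ys)

    suc-length-filter-≢ : ∀ {z} {xs : List A} → Unique xs → z ∈ xs →
                          suc (length (filter (λ x → ¬? (x ≟ z)) xs)) ≡ length xs
    suc-length-filter-≢ {z} {x ∷ xs} (x∉xs ∷ _) (here refl) with x ≟ x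
    ... | yes _   = cong (suc ∘ length)
                      (List.filter-all (λ y → ¬? (y ≟ z)) (All.map (λ x≢y y≡x → x≢y (sym y≡x)) x∉xs))
    ... | no x≢x  = contradiction refl x≢x
    suc-length-filter-≢ {z} {x ∷ xs} (x∉xs ∷ xs!) (there z∈xs) with x ≟ z
    ... | yes x≡z = contradiction x≡z (All.lookup x∉xs z∈xs)
    ... | no _    = cong suc (suc-length-filter-≢ xs! z∈xs)

length-filter+length-filter∁ : ∀ {A : Set} {P : Pred A 0ℓ} (P? : Decidable P) xs →
                               length (filter P? xs) ℕ.+ length (filter (∁? P?) xs) ≡ length xs
length-filter+length-filter∁ P? []       = refl
length-filter+length-filter∁ P? (x ∷ xs) with P? x
... | yes _ = cong suc (length-filter+length-filter∁ P? xs)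
... | no  _ = trans (ℕ.+-suc _ _) (cong suc (length-filter+length-filter∁ P? xs))

module _ {A B : Set} (_≟_ : DecidableEquality B) (f : A → B) {k : ℕ}
         (fibre-bound : ∀ y {zs} → Unique zs → All (λ z → f z ≡ y) zs → length zs ≤ k) where

  bounded-fibres⇒length≤ : ∀ ys {xs} → Unique xs → All (λ x → f x ∈ ys) xs → length xs ≤ length ys ℕ.* k
  bounded-fibres⇒length≤ []       {[]}    _   _        = z≤n
  bounded-fibres⇒length≤ []       {_ ∷ _} _   (() ∷ _)
  bounded-fibres⇒length≤ (y ∷ ys) {xs}    xs! f[xs]⊆ = begin
    length xs
      ≡⟨ length-filter+length-filter∁ P? xs ⟨
    length (filter P? xs) ℕ.+ length (filter (∁? P?) xs)
      ≤⟨ ℕ.+-mono-≤ (fibre-bound y (Unique.filter⁺ P? xs!) (All.all-filter P? xs))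
                    (bounded-fibres⇒length≤ ys (Unique.filter⁺ (∁? P?) xs!) (All.tabulate rest)) ⟩
    k ℕ.+ length ys ℕ.* k ∎
    where
    open ℕ.≤-Reasoning
    P? = λ x → f x ≟ y
    rest : ∀ {x} → x ∈ filter (∁? P?) xs → f x ∈ ys
    rest x∈ with ∈.∈-filter⁻ (∁? P?) x∈
    ... | x∈xs , fx≢y with All.lookup f[xs]⊆ x∈xs
    ...   | here fx≡y  = contradiction fx≡y fx≢y
    ...   | there fx∈ys = fx∈ys

module BigOperator {A : Set} {_∙_ : Op₂ A} {ε : A}
                   (isCommutativeMonoid : IsCommutativeMonoid _≡_ _∙_ ε) where

  open IsCommutativeMonoid isCommutativeMonoid using (assoc; identityˡ; identityʳ)
  private
    commutativeSemigroup : CommutativeSemigroup 0ℓ 0ℓ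
    commutativeSemigroup = record
      { isCommutativeSemigroup = IsCommutativeMonoid.isCommutativeSemigroup isCommutativeMonoid }

  open import Algebra.Properties.CommutativeSemigroup commutativeSemigroup using (interchange)

  ⨁ : ∀ {I : Set} → List I → (I → A) → A
  ⨁ xs f = foldr _∙_ ε (map f xs)

  module _ {I : Set} where

    ⨁-cong : ∀ (xs : List I) {f g} → (∀ {x} → x ∈ xs → f x ≡ g x) → ⨁ xs f ≡ ⨁ xs g
    ⨁-cong []       _   = refl
    ⨁-cong (x ∷ xs) f≗g = cong₂ _∙_ (f≗g (here refl)) (⨁-cong xs (f≗g ∘ there))

    ⨁-distrib : ∀ (xs : List I) f g → ⨁ xs (λ x → f x ∙ g x) ≡ ⨁ xs f ∙ ⨁ xs g
    ⨁-distrib []       f g = sym (identityˡ ε)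
    ⨁-distrib (x ∷ xs) f g = trans (cong ((f x ∙ g x) ∙_) (⨁-distrib xs f g)) (interchange _ _ _ _)

    ⨁-homo : ∀ (h : A → A) → h ε ≡ ε → (∀ a b → h (a ∙ b) ≡ h a ∙ h b) →
             ∀ (xs : List I) f → ⨁ xs (h ∘ f) ≡ h (⨁ xs f)
    ⨁-homo h h-ε h-∙ []       f = sym h-ε
    ⨁-homo h h-ε h-∙ (x ∷ xs) f = trans (cong (h (f x) ∙_) (⨁-homo h h-ε h-∙ xs f)) (sym (h-∙ _ _))

    ⨁-identity : ∀ (xs : List I) {f} → (∀ {x} → x ∈ xs → f x ≡ ε) → ⨁ xs f ≡ ε
    ⨁-identity xs {f} f≗ε = trans (⨁-cong xs f≗ε) (⨁-homo (λ _ → ε) refl (λ _ _ → sym (identityˡ ε)) xs f)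

    ⨁-single : ∀ {xs : List I} {z f} → Unique xs → z ∈ xs → (∀ {x} → x ∈ xs → x ≢ z → f x ≡ ε) → ⨁ xs f ≡ f z
    ⨁-single {x ∷ xs} (x∉xs ∷ _) (here refl) rest-ε =
      trans (cong (_ ∙_) (⨁-identity xs λ x∈ → rest-ε (there x∈) λ x≡z → All.lookup x∉xs x∈ (sym x≡z)))
            (identityʳ _)
    ⨁-single {x ∷ xs} (x∉xs ∷ xs!) (there z∈xs) rest-ε =
      trans (cong₂ _∙_ (rest-ε (here refl) λ x≡z → All.lookup x∉xs z∈xs x≡z) (⨁-single xs! z∈xs (rest-ε ∘ there)))
            (identityˡ _)

    ⨁-++ : ∀ (xs ys : List I) f → ⨁ (xs ++ ys) f ≡ ⨁ xs f ∙ ⨁ ys f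
    ⨁-++ []       ys f = sym (identityˡ _)
    ⨁-++ (x ∷ xs) ys f = trans (cong (f x ∙_) (⨁-++ xs ys f)) (sym (assoc _ _ _))

    ⨁-map : ∀ {J : Set} (g : J → I) (xs : List J) f → ⨁ (map g xs) f ≡ ⨁ xs (f ∘ g)
    ⨁-map g xs f = cong (foldr _∙_ ε) (sym (List.map-∘ xs))

    ⨁-concatMap : ∀ {J : Set} (G : J → List I) (ys : List J) f →
                  ⨁ (List.concatMap G ys) f ≡ ⨁ ys (λ y → ⨁ (G y) f)
    ⨁-concatMap G []       f = refl
    ⨁-concatMap G (y ∷ ys) f = trans (⨁-++ (G y) _ f) (cong (_ ∙_) (⨁-concatMap G ys f))

    ⨁-↭ : ∀ {xs ys : List I} f → xs ↭ ys → ⨁ xs f ≡ ⨁ ys f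
    ⨁-↭ f xs↭ys = Setoid↭.foldr-commMonoid (≡.setoid A) isCommutativeMonoid
                    (↭⇒↭ₛ′ ≡.isEquivalence (↭.map⁺ f xs↭ys))

  ⨁-reindex : ∀ {xs : List A} (σ τ : A → A) → Unique xs →
              (∀ {x} → x ∈ xs → σ x ∈ xs) → (∀ {x} → x ∈ xs → τ x ∈ xs) →
              (∀ x → σ (τ x) ≡ x) → (∀ x → τ (σ x) ≡ x) → ∀ f → ⨁ xs (f ∘ σ) ≡ ⨁ xs f
  ⨁-reindex {xs} σ τ xs! σ∈ τ∈ στ τσ f =
    trans (sym (⨁-map σ xs f)) (⨁-↭ f (map-inverse-↭ σ τ xs! σ∈ τ∈ στ τσ))

[1+k]*[1+n]C[1+k]≡[1+n]*nCk : ∀ n k → suc k ℕ.* (suc n C suc k) ≡ suc n ℕ.* (n C k)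
[1+k]*[1+n]C[1+k]≡[1+n]*nCk zero    zero    = refl
[1+k]*[1+n]C[1+k]≡[1+n]*nCk zero    (suc k) = ℕ.*-zeroʳ (suc (suc k))
[1+k]*[1+n]C[1+k]≡[1+n]*nCk (suc n) zero    =
  trans (ℕ.*-identityˡ _) (trans (nC1≡n (suc (suc n))) (sym (ℕ.*-identityʳ _)))
[1+k]*[1+n]C[1+k]≡[1+n]*nCk (suc n) (suc k) = begin
  suc (suc k) ℕ.* (suc (suc n) C suc (suc k))
    ≡⟨ cong (suc (suc k) ℕ.*_) (nCk+nC[k+1]≡[n+1]C[k+1] (suc n) (suc k)) ⟨
  suc (suc k) ℕ.* (A ℕ.+ B)
    ≡⟨ regroup k A B ⟩
  A ℕ.+ (suc k ℕ.* A ℕ.+ suc (suc k) ℕ.* B)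
    ≡⟨ cong₂ (λ u v → A ℕ.+ (u ℕ.+ v))
             ([1+k]*[1+n]C[1+k]≡[1+n]*nCk n k) ([1+k]*[1+n]C[1+k]≡[1+n]*nCk n (suc k)) ⟩
  A ℕ.+ (suc n ℕ.* (n C k) ℕ.+ suc n ℕ.* (n C suc k))
    ≡⟨ cong (A ℕ.+_) (ℕ.*-distribˡ-+ (suc n) (n C k) (n C suc k)) ⟨
  A ℕ.+ suc n ℕ.* (n C k ℕ.+ n C suc k)
    ≡⟨ cong (λ c → A ℕ.+ suc n ℕ.* c) (nCk+nC[k+1]≡[n+1]C[k+1] n k) ⟩
  suc (suc n) ℕ.* A ∎
  where
  open ≡-Reasoning
  A = suc n C suc k
  B = suc n C suc (suc k)
  regroup : ∀ k a b → suc (suc k) ℕ.* (a ℕ.+ b) ≡ a ℕ.+ (suc k ℕ.* a ℕ.+ suc (suc k) ℕ.* b)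
  regroup = solve-∀

prime∣pCk : ∀ {p k} → Prime p → 0 < k → k < p → p ∣ p C k
prime∣pCk {suc n} {suc k} p-prime _ k<p
  with euclidsLemma (suc k) (suc n C suc k) p-prime
         (divides (n C k) (trans ([1+k]*[1+n]C[1+k]≡[1+n]*nCk n k) (ℕ.*-comm (suc n) (n C k))))
... | inj₁ p∣1+k = contradiction (∣⇒≤ p∣1+k) (ℕ.<⇒≱ k<p)
... | inj₂ p∣pCk = p∣pCk

n%2≡1⇒n≡1+[n/2]*2 : ∀ n → n % 2 ≡ 1 → n ≡ suc (n / 2 ℕ.* 2)
n%2≡1⇒n≡1+[n/2]*2 n n%2≡1 = trans (m≡m%n+[m/n]*n n 2) (cong (ℕ._+ n / 2 ℕ.* 2) n%2≡1)

n%2≢1⇒n≡[n/2]*2 : ∀ n → n % 2 ≢ 1 → n ≡ n / 2 ℕ.* 2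
n%2≢1⇒n≡[n/2]*2 n n%2≢1 =
  trans (m≡m%n+[m/n]*n n 2) (cong (ℕ._+ n / 2 ℕ.* 2) (r<2∧r≢1⇒r≡0 (m%n<n n 2) n%2≢1))
  where
  r<2∧r≢1⇒r≡0 : ∀ {r} → r < 2 → r ≢ 1 → r ≡ 0
  r<2∧r≢1⇒r≡0 {zero}          _              _   = refl
  r<2∧r≢1⇒r≡0 {suc zero}      _              r≢1 = contradiction refl r≢1
  r<2∧r≢1⇒r≡0 {suc (suc _)}   (s≤s (s≤s ())) _

module FiniteFieldTheory (F : FiniteField) where

  open FiniteField F

  commutativeRing : CommutativeRing 0ℓ 0ℓ
  commutativeRing = record { isCommutativeRing = isCommutativeRing }

  open CommutativeRing commutativeRing using
    ( _-_; +-assoc; +-comm; +-identityˡ; +-identityʳ; -‿inverseˡ; -‿inverseʳ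
    ; *-assoc; *-comm; *-identityˡ; *-identityʳ; distribˡ; distribʳ; zeroˡ; zeroʳ
    ; ring; semiring; commutativeSemiring; +-monoid; +-isCommutativeMonoid; *-isCommutativeMonoid )
  open import Algebra.Properties.Ring ring using
    ( -‿involutive; -‿injective; +-cancelʳ; -‿distribʳ-*; -0#≈0#; -‿+-comm; -1*x≈-x; +-identityʳ-unique
    ; +-inverseˡ-unique; +-inverseʳ-unique; x∙y⁻¹≈ε⇒x≈y; //-rightDividesˡ; //-rightDividesʳ )
  open import Algebra.Properties.Monoid.Mult +-monoid using (×-assocˡ) renaming (_×_ to _·_)
  open import Algebra.Properties.Semiring.Mult semiring using (×1-homo-*; ×-assoc-*)
  open IntegerCoefficientRingSolver commutativeRing
  open ≡-Reasoning

  1≢0 : 1# ≢ 0#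
  1≢0 = 0≢1 ∘ sym

  -1≢0 : - 1# ≢ 0#
  -1≢0 -1≡0 = 1≢0 (trans (sym (-‿involutive 1#)) (trans (cong -_ -1≡0) -0#≈0#))

  inverseˡ : ∀ {x} → x ≢ 0# → x ⁻¹ * x ≡ 1#
  inverseˡ {x} x≢0 = trans (*-comm _ _) (inverseʳ x x≢0)

  x⁻¹*[x*y]≡y : ∀ {x} y → x ≢ 0# → x ⁻¹ * (x * y) ≡ y
  x⁻¹*[x*y]≡y {x} y x≢0 = trans (sym (*-assoc _ _ _)) (trans (cong (_* y) (inverseˡ x≢0)) (*-identityˡ y))

  x*[x⁻¹*y]≡y : ∀ {x} → x ≢ 0# → ∀ y → x * (x ⁻¹ * y) ≡ y
  x*[x⁻¹*y]≡y {x} x≢0 y = trans (sym (*-assoc _ _ _)) (trans (cong (_* y) (inverseʳ x x≢0)) (*-identityˡ y))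

  *-cancelˡ : ∀ {x y z} → x ≢ 0# → x * y ≡ x * z → y ≡ z
  *-cancelˡ {x} {y} {z} x≢0 xy≡xz =
    trans (sym (x⁻¹*[x*y]≡y y x≢0)) (trans (cong (x ⁻¹ *_) xy≡xz) (x⁻¹*[x*y]≡y z x≢0))

  x*y≡0⇒x≡0⊎y≡0 : ∀ {x y} → x * y ≡ 0# → x ≡ 0# ⊎ y ≡ 0#
  x*y≡0⇒x≡0⊎y≡0 {x} {y} xy≡0 with x ≟ 0#
  ... | yes x≡0 = inj₁ x≡0
  ... | no  x≢0 = inj₂ (*-cancelˡ x≢0 (trans xy≡0 (sym (zeroʳ x))))

  *-≢0 : ∀ {x y} → x ≢ 0# → y ≢ 0# → x * y ≢ 0#
  *-≢0 x≢0 y≢0 = [ x≢0 , y≢0 ]′ ∘ x*y≡0⇒x≡0⊎y≡0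

  ⁻¹-unique : ∀ {x y} → x * y ≡ 1# → y ≡ x ⁻¹
  ⁻¹-unique {x} {y} xy≡1 = *-cancelˡ x≢0 (trans xy≡1 (sym (inverseʳ x x≢0)))
    where
    x≢0 : x ≢ 0#
    x≢0 x≡0 = 0≢1 (trans (sym (zeroˡ y)) (trans (cong (_* y) (sym x≡0)) xy≡1))

  ⁻¹-≢0 : ∀ {x} → x ≢ 0# → x ⁻¹ ≢ 0#
  ⁻¹-≢0 {x} x≢0 x⁻¹≡0 = 0≢1 (trans (sym (zeroʳ x)) (trans (cong (x *_) (sym x⁻¹≡0)) (inverseʳ x x≢0)))

  ⁻¹-distrib-* : ∀ {x y} → x ≢ 0# → y ≢ 0# → (x * y) ⁻¹ ≡ x ⁻¹ * y ⁻¹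
  ⁻¹-distrib-* {x} {y} x≢0 y≢0 = sym (⁻¹-unique (begin
    (x * y) * (x ⁻¹ * y ⁻¹)
      ≡⟨ solve 4 (λ x y x' y' → (x :* y) :* (x' :* y') := (x :* x') :* (y :* y')) refl x y (x ⁻¹) (y ⁻¹) ⟩
    (x * x ⁻¹) * (y * y ⁻¹)
      ≡⟨ cong₂ _*_ (inverseʳ x x≢0) (inverseʳ y y≢0) ⟩
    1# * 1#
      ≡⟨ *-identityˡ 1# ⟩
    1# ∎))

  1⁻¹≡1 : 1# ⁻¹ ≡ 1#
  1⁻¹≡1 = sym (⁻¹-unique (*-identityˡ 1#))

  -1⁻¹≡-1 : (- 1#) ⁻¹ ≡ - 1#
  -1⁻¹≡-1 = sym (⁻¹-unique (trans (-1*x≈-x (- 1#)) (-‿involutive 1#)))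

  x-y≡0⇒x≡y : ∀ {x y} → x - y ≡ 0# → x ≡ y
  x-y≡0⇒x≡y = x∙y⁻¹≈ε⇒x≈y _ _

  x≢y⇒x-y≢0 : ∀ {x y} → x ≢ y → x - y ≢ 0#
  x≢y⇒x-y≢0 x≢y = x≢y ∘ x-y≡0⇒x≡y

  x+y≡0⇒x≡-y : ∀ {x y} → x + y ≡ 0# → x ≡ - y
  x+y≡0⇒x≡-y = +-inverseˡ-unique _ _

  import Algebra.Properties.CommutativeSemiring.Exp commutativeSemiring as ᴿ
  import Algebra.Properties.CommutativeSemiring.Binomial commutativeSemiring as Binomial
  open import Algebra.Properties.Monoid.Sum +-monoid using (sum-init-last; sum-cong-≗; sum-replicate-zero)
    renaming (sum to ∑ᵥ)

  -- The library's power ᴿ._^_ unfolds like the one in Defs, so its lemmas transfer.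
  ^≡^ᴿ : ∀ x n → x ^ n ≡ x ᴿ.^ n
  ^≡^ᴿ x zero    = refl
  ^≡^ᴿ x (suc n) = cong (x *_) (^≡^ᴿ x n)

  ^-assocʳ : ∀ x m n → (x ^ m) ^ n ≡ x ^ (m ℕ.* n)
  ^-assocʳ x m n rewrite ^≡^ᴿ x m | ^≡^ᴿ (x ᴿ.^ m) n | ^≡^ᴿ x (m ℕ.* n) = ᴿ.^-assocʳ x m n

  ^-distrib-* : ∀ x y n → (x * y) ^ n ≡ x ^ n * y ^ n
  ^-distrib-* x y n rewrite ^≡^ᴿ (x * y) n | ^≡^ᴿ x n | ^≡^ᴿ y n = ᴿ.^-distrib-* x y n

  1^n≡1 : ∀ n → 1# ^ n ≡ 1#
  1^n≡1 zero    = refl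
  1^n≡1 (suc n) = trans (*-identityˡ _) (1^n≡1 n)

  ^-≢0 : ∀ {x} n → x ≢ 0# → x ^ n ≢ 0#
  ^-≢0 zero    x≢0 = 1≢0
  ^-≢0 (suc n) x≢0 = *-≢0 x≢0 (^-≢0 n x≢0)

  ^≡0⇒≡0 : ∀ {x} n → x ^ n ≡ 0# → x ≡ 0#
  ^≡0⇒≡0 {x} n xⁿ≡0 with x ≟ 0#
  ... | yes x≡0 = x≡0
  ... | no  x≢0 = contradiction xⁿ≡0 (^-≢0 n x≢0)

  0^≡0 : ∀ {k} → 1 ≤ k → 0# ^ k ≡ 0#
  0^≡0 (s≤s _) = zeroˡ _

  ⁻¹-^ : ∀ {x} n → x ≢ 0# → (x ^ n) ⁻¹ ≡ (x ⁻¹) ^ n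
  ⁻¹-^ {x} n x≢0 = sym (⁻¹-unique (begin
    x ^ n * (x ⁻¹) ^ n   ≡⟨ ^-distrib-* x (x ⁻¹) n ⟨
    (x * x ⁻¹) ^ n       ≡⟨ cong (_^ n) (inverseʳ x x≢0) ⟩
    1# ^ n               ≡⟨ 1^n≡1 n ⟩
    1#                   ∎))

  g-0 : ∀ q → g q 0# ≡ 0#
  g-0 q with 0# ≟ 0#
  ... | yes _   = refl
  ... | no 0≢0  = contradiction refl 0≢0

  g[x]≡[x^[q-1]]⁻¹ : ∀ q {x} → x ≢ 0# → g q x ≡ (x ^ (q ℕ.∸ 1)) ⁻¹
  g[x]≡[x^[q-1]]⁻¹ q {x} x≢0 with x ≟ 0#
  ... | yes x≡0 = contradiction x≡0 x≢0
  ... | no _    = refl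

  g≢0 : ∀ q {x} → x ≢ 0# → g q x ≢ 0#
  g≢0 q {x} x≢0 rewrite g[x]≡[x^[q-1]]⁻¹ q x≢0 = ⁻¹-≢0 (^-≢0 (q ℕ.∸ 1) x≢0)

  g-homo-* : ∀ q x y → g q (x * y) ≡ g q x * g q y
  g-homo-* q x y = by-cases (x ≟ 0#) (y ≟ 0#)
    where
    by-cases : Dec (x ≡ 0#) → Dec (y ≡ 0#) → g q (x * y) ≡ g q x * g q y
    by-cases (yes refl) _ = begin
      g q (0# * y)       ≡⟨ cong (g q) (zeroˡ y) ⟩
      g q 0#             ≡⟨ g-0 q ⟩
      0#                 ≡⟨ zeroˡ _ ⟨
      0# * g q y         ≡⟨ cong (_* g q y) (g-0 q) ⟨
      g q 0# * g q y     ∎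
    by-cases (no _) (yes refl) = begin
      g q (x * 0#)       ≡⟨ cong (g q) (zeroʳ x) ⟩
      g q 0#             ≡⟨ g-0 q ⟩
      0#                 ≡⟨ zeroʳ _ ⟨
      g q x * 0#         ≡⟨ cong (g q x *_) (g-0 q) ⟨
      g q x * g q 0#     ∎
    by-cases (no x≢0) (no y≢0) = begin
      g q (x * y)
        ≡⟨ g[x]≡[x^[q-1]]⁻¹ q (*-≢0 x≢0 y≢0) ⟩
      ((x * y) ^ (q ℕ.∸ 1)) ⁻¹
        ≡⟨ cong _⁻¹ (^-distrib-* x y (q ℕ.∸ 1)) ⟩
      (x ^ (q ℕ.∸ 1) * y ^ (q ℕ.∸ 1)) ⁻¹
        ≡⟨ ⁻¹-distrib-* (^-≢0 (q ℕ.∸ 1) x≢0) (^-≢0 (q ℕ.∸ 1) y≢0) ⟩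
      (x ^ (q ℕ.∸ 1)) ⁻¹ * (y ^ (q ℕ.∸ 1)) ⁻¹
        ≡⟨ cong₂ _*_ (g[x]≡[x^[q-1]]⁻¹ q x≢0) (g[x]≡[x^[q-1]]⁻¹ q y≢0) ⟨
      g q x * g q y ∎

  open BigOperator +-isCommutativeMonoid using () renaming
    ( ⨁ to ∑; ⨁-cong to ∑-cong; ⨁-distrib to ∑-distrib-+; ⨁-homo to ∑-homo
    ; ⨁-identity to ∑-zero; ⨁-single to ∑-single; ⨁-map to ∑-map; ⨁-concatMap to ∑-concatMap
    ; ⨁-reindex to ∑-reindex )
  open BigOperator *-isCommutativeMonoid using () renaming
    ( ⨁ to ∏; ⨁-distrib to ∏-distrib-*; ⨁-reindex to ∏-reindex )

  ∑-const : ∀ {I : Set} (xs : List I) c → ∑ xs (λ _ → c) ≡ length xs · c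
  ∑-const []       c = refl
  ∑-const (x ∷ xs) c = cong (c +_) (∑-const xs c)

  *-distribˡ-∑ : ∀ {I : Set} c (xs : List I) f → ∑ xs (λ x → c * f x) ≡ c * ∑ xs f
  *-distribˡ-∑ c = ∑-homo (c *_) (zeroʳ c) (distribˡ c)

  ∑-neg : ∀ {I : Set} (xs : List I) f → ∑ xs (λ x → - f x) ≡ - ∑ xs f
  ∑-neg = ∑-homo -_ -0#≈0# (λ a b → sym (-‿+-comm a b))

  ∏-const : ∀ {I : Set} (xs : List I) c → ∏ xs (λ _ → c) ≡ c ^ length xs
  ∏-const []       c = refl
  ∏-const (x ∷ xs) c = cong (c *_) (∏-const xs c)

  ∏-≢0 : ∀ xs → (∀ {x} → x ∈ xs → x ≢ 0#) → ∏ xs id ≢ 0#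
  ∏-≢0 []       _      = 1≢0
  ∏-≢0 (x ∷ xs) xs≢0 = *-≢0 (xs≢0 (here refl)) (∏-≢0 xs (xs≢0 ∘ there))

  ∑-vecs-suc : ∀ k xs (f : Vec Carrier (suc k) → Carrier) →
               ∑ (vecs (suc k) xs) f ≡ ∑ xs (λ x → ∑ (vecs k xs) (λ cs → f (x ∷ cs)))
  ∑-vecs-suc k xs f = trans (∑-concatMap _ xs f) (∑-cong xs (λ {x} _ → ∑-map (x ∷_) (vecs k xs) f))

  affineSum-1 : ∀ q f a b → affineSum q f a (b ∷ []) ≡ ∑ (subElements q) (λ c → f (a + c * b))
  affineSum-1 q f a b = trans (∑-vecs-suc 0 (subElements q) _)
    (∑-cong (subElements q) λ _ → trans (+-identityʳ _) (cong (λ z → f (a + z)) (+-identityʳ _)))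

  affineSum-2 : ∀ q f a b₁ b₂ → affineSum q f a (b₁ ∷ b₂ ∷ []) ≡
                ∑ (subElements q) (λ c₁ → ∑ (subElements q) (λ c₂ → f ((a + c₁ * b₁) + c₂ * b₂)))
  affineSum-2 q f a b₁ b₂ = trans (∑-vecs-suc 1 (subElements q) _) (∑-cong (subElements q) λ {c₁} _ →
    trans (∑-vecs-suc 0 (subElements q) _) (∑-cong (subElements q) λ {c₂} _ →
      trans (+-identityʳ _) (cong f (trans (cong (λ z → a + (c₁ * b₁ + z)) (+-identityʳ _)) (sym (+-assoc _ _ _))))))

  -- Characteristic, Frobenius and Fermat

  Additive : ℕ → Set
  Additive e = ∀ x y → (x + y) ^ e ≡ x ^ e + y ^ e

  additive-1 : Additive 1
  additive-1 x y = trans (*-identityʳ _) (sym (cong₂ _+_ (*-identityʳ x) (*-identityʳ y)))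

  additive-* : ∀ a b → Additive a → Additive b → Additive (a ℕ.* b)
  additive-* a b add-a add-b x y = begin
    (x + y) ^ (a ℕ.* b)          ≡⟨ ^-assocʳ (x + y) a b ⟨
    ((x + y) ^ a) ^ b            ≡⟨ cong (_^ b) (add-a x y) ⟩
    (x ^ a + y ^ a) ^ b          ≡⟨ add-b _ _ ⟩
    (x ^ a) ^ b + (y ^ a) ^ b    ≡⟨ cong₂ _+_ (^-assocʳ x a b) (^-assocʳ y a b) ⟩
    x ^ (a ℕ.* b) + y ^ (a ℕ.* b) ∎

  additive-^ : ∀ a k → Additive a → Additive (a ℕ.^ k)
  additive-^ a zero    _     = additive-1
  additive-^ a (suc k) add-a = additive-* a (a ℕ.^ k) add-a (additive-^ a k add-a)

  additive-neg : ∀ {e} → 1 ≤ e → Additive e → ∀ x → (- x) ^ e ≡ - (x ^ e)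
  additive-neg {suc e} _ add x = +-inverseʳ-unique _ _ (begin
    x ^ suc e + (- x) ^ suc e    ≡⟨ add x (- x) ⟨
    (x - x) ^ suc e              ≡⟨ cong (_^ suc e) (-‿inverseʳ x) ⟩
    0# ^ suc e                   ≡⟨ zeroˡ _ ⟩
    0#                           ∎)

  additive-sub : ∀ {e} → 1 ≤ e → Additive e → ∀ x y → (x - y) ^ e ≡ x ^ e - y ^ e
  additive-sub {e} 1≤e add x y = trans (add x (- y)) (cong (x ^ e +_) (additive-neg 1≤e add y))

  translation-closed⇒length·≡0 : ∀ {xs} d → Unique xs →
    (∀ {x} → x ∈ xs → x + d ∈ xs) → (∀ {x} → x ∈ xs → x - d ∈ xs) → length xs · d ≡ 0#
  translation-closed⇒length·≡0 {xs} d xs! +d∈ -d∈ = +-identityʳ-unique (∑ xs id) _ (begin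
    ∑ xs id + length xs · d
      ≡⟨ cong (∑ xs id +_) (∑-const xs d) ⟨
    ∑ xs id + ∑ xs (λ _ → d)
      ≡⟨ ∑-distrib-+ xs id (λ _ → d) ⟨
    ∑ xs (λ x → x + d)
      ≡⟨ ∑-reindex (_+ d) (_- d) xs! +d∈ -d∈ (//-rightDividesˡ d) (//-rightDividesʳ d) id ⟩
    ∑ xs id ∎)

  size·≡0 : ∀ x → size · x ≡ 0#
  size·≡0 x = translation-closed⇒length·≡0 x unique (λ _ → complete _) (λ _ → complete _)

  ^·1 : ∀ m k → (m ℕ.^ k) · 1# ≡ (m · 1#) ^ k
  ^·1 m zero    = +-identityʳ 1#
  ^·1 m (suc k) = trans (×1-homo-* m (m ℕ.^ k)) (cong (m · 1# *_) (^·1 m k))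

  characteristic : ∀ p k → size ≡ p ℕ.^ k → p · 1# ≡ 0#
  characteristic p k size≡pᵏ =
    ^≡0⇒≡0 k (trans (sym (^·1 p k)) (trans (cong (_· 1#) (sym size≡pᵏ)) (size·≡0 1#)))

  ∣⇒·≡0 : ∀ {p m} x → p · 1# ≡ 0# → p ∣ m → m · x ≡ 0#
  ∣⇒·≡0 {p} x p·1≡0 (divides d refl) = begin
    (d ℕ.* p) · x          ≡⟨ cong (_· x) (ℕ.*-comm d p) ⟩
    (p ℕ.* d) · x          ≡⟨ ×-assocˡ x p d ⟨
    p · (d · x)            ≡⟨ cong (p ·_) (*-identityˡ _) ⟨
    p · (1# * d · x)       ≡⟨ ×-assoc-* p 1# (d · x) ⟨
    (p · 1#) * d · x       ≡⟨ cong (_* d · x) p·1≡0 ⟩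
    0# * d · x             ≡⟨ zeroˡ _ ⟩
    0#                     ∎

  -- Binomial theorem: all coefficients but the outer two are multiples of p.
  prime⇒additive : ∀ {p} → Prime p → p · 1# ≡ 0# → Additive p
  prime⇒additive {suc p-1} p-prime p·1≡0 x y = begin
    (x + y) ^ p
      ≡⟨ ^≡^ᴿ (x + y) p ⟩
    (x + y) ᴿ.^ p
      ≡⟨ Binomial.theorem p x y ⟩
    term 0F + ∑ᵥ (tail term)
      ≡⟨ cong (term 0F +_) (sum-init-last (tail term)) ⟩
    term 0F + (∑ᵥ (init (tail term)) + last (tail term))
      ≡⟨ cong₂ (λ a b → term 0F + (a + b)) (trans (sum-cong-≗ middle-term) (sum-replicate-zero p-1)) last-term ⟩
    term 0F + (0# + x ^ p)
      ≡⟨ cong₂ _+_ first-term (+-identityˡ _) ⟩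
    y ^ p + x ^ p
      ≡⟨ +-comm _ _ ⟩
    x ^ p + y ^ p ∎
    where
    p = suc p-1
    term = Binomial.binomialTerm x y p
    first-term : term 0F ≡ y ^ p
    first-term = trans (+-identityʳ _) (trans (*-identityˡ _) (sym (^≡^ᴿ y p)))
    middle-term : ∀ i → init (tail term) i ≡ 0#
    middle-term i = ∣⇒·≡0 _ p·1≡0
      (prime∣pCk p-prime (s≤s z≤n) (s≤s (subst (_< p-1) (sym (Fin.toℕ-inject₁ i)) (Fin.toℕ<n i))))
    last-term : last (tail term) ≡ x ^ p
    last-term = begin
      last (tail term)
        ≡⟨ cong (λ k → (p C suc k) · (x ᴿ.^ suc k * y ᴿ.^ (p-1 ℕ.∸ k))) (Fin.toℕ-fromℕ p-1) ⟩
      (p C p) · (x ᴿ.^ p * y ᴿ.^ (p-1 ℕ.∸ p-1))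
        ≡⟨ cong₂ (λ c k → c · (x ᴿ.^ p * y ᴿ.^ k)) (nCn≡1 p) (ℕ.n∸n≡0 p-1) ⟩
      (x ᴿ.^ p * 1#) + 0#
        ≡⟨ trans (+-identityʳ _) (*-identityʳ _) ⟩
      x ᴿ.^ p
        ≡⟨ ^≡^ᴿ x p ⟨
      x ^ p ∎

  units : List Carrier
  units = filter (λ x → ¬? (x ≟ 0#)) elements

  ∈units : ∀ {x} → x ≢ 0# → x ∈ units
  ∈units x≢0 = ∈.∈-filter⁺ (λ x → ¬? (x ≟ 0#)) (complete _) x≢0

  units-≢0 : ∀ {x} → x ∈ units → x ≢ 0#
  units-≢0 x∈ = proj₂ (∈.∈-filter⁻ (λ x → ¬? (x ≟ 0#)) {xs = elements} x∈)

  -- Multiplication by a permutes the units.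
  ^length-units≡1 : ∀ {a} → a ≢ 0# → a ^ length units ≡ 1#
  ^length-units≡1 {a} a≢0 = *-cancelˡ (∏-≢0 units units-≢0) (begin
    P * a ^ length units
      ≡⟨ *-comm _ _ ⟩
    a ^ length units * P
      ≡⟨ cong (_* P) (∏-const units a) ⟨
    ∏ units (λ _ → a) * P
      ≡⟨ ∏-distrib-* units (λ _ → a) id ⟨
    ∏ units (a *_)
      ≡⟨ ∏-reindex (a *_) (a ⁻¹ *_) units! a*∈ a⁻¹*∈ (x*[x⁻¹*y]≡y a≢0) (λ y → x⁻¹*[x*y]≡y y a≢0) id ⟩
    P
      ≡⟨ *-identityʳ P ⟨
    P * 1# ∎)
    where
    P = ∏ units id
    units! = Unique.filter⁺ (λ x → ¬? (x ≟ 0#)) unique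
    a*∈ : ∀ {x} → x ∈ units → a * x ∈ units
    a*∈ x∈ = ∈units (*-≢0 a≢0 (units-≢0 x∈))
    a⁻¹*∈ : ∀ {x} → x ∈ units → a ⁻¹ * x ∈ units
    a⁻¹*∈ x∈ = ∈units (*-≢0 (⁻¹-≢0 a≢0) (units-≢0 x∈))

  x^size≡x : ∀ x → x ^ size ≡ x
  x^size≡x x = trans (cong (x ^_) (sym 1+length-units≡size)) (by-cases (x ≟ 0#))
    where
    1+length-units≡size : suc (length units) ≡ size
    1+length-units≡size = suc-length-filter-≢ _≟_ unique (complete 0#)
    by-cases : Dec (x ≡ 0#) → x ^ suc (length units) ≡ x
    by-cases (yes refl) = zeroˡ _
    by-cases (no x≢0)   = trans (cong (x *_) (^length-units≡1 x≢0)) (*-identityʳ x)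

  -- Polynomial functions

  -- horner t (a₀ ∷ … ∷ a_{d-1} ∷ []) x = a₀ + a₁ x + … + a_{d-1} x^{d-1} + t x^d
  horner : ∀ {d} → Carrier → Vec Carrier d → Carrier → Carrier
  horner t []       x = t
  horner t (a ∷ as) x = a + x * horner t as x

  Degree< : ℕ → (Carrier → Carrier) → Set
  Degree< d f = Σ[ as ∈ Vec Carrier d ] (∀ x → f x ≡ horner 0# as x)

  Monic : ℕ → (Carrier → Carrier) → Set
  Monic d f = Σ[ as ∈ Vec Carrier d ] (∀ x → f x ≡ horner 1# as x)

  quotient : ∀ {d} → Carrier → Vec Carrier (suc d) → Carrier → Vec Carrier d
  quotient t (a ∷ [])         r = []
  quotient t (a ∷ as@(_ ∷ _)) r = horner t as r ∷ quotient t as r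

  horner-division : ∀ t {d} (as : Vec Carrier (suc d)) r x →
                    horner t as x ≡ horner t as r + (x - r) * horner t (quotient t as r) x
  horner-division t (a ∷ [])         r x =
    solve 4 (λ a t r x → a :+ x :* t := (a :+ r :* t) :+ (x :- r) :* t) refl a t r x
  horner-division t (a ∷ as@(_ ∷ _)) r x = trans (cong (λ h → a + x * h) (horner-division t as r x))
    (solve 5 (λ a x r h q → a :+ x :* (h :+ (x :- r) :* q) := (a :+ r :* h) :+ (x :- r) :* (h :+ x :* q))
             refl a x r (horner t as r) (horner t (quotient t as r) x))

  quotient-roots : ∀ t {d} (as : Vec Carrier (suc d)) {r rs} → Unique (r ∷ rs) →
                   All (λ y → horner t as y ≡ 0#) (r ∷ rs) → All (λ y → horner t (quotient t as r) y ≡ 0#) rs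
  quotient-roots t as {r} (r∉rs ∷ _) (r-root ∷ rs-roots) = All.tabulate λ {y} y∈rs →
    [ (λ y-r≡0 → contradiction (x-y≡0⇒x≡y y-r≡0) (λ y≡r → All.lookup r∉rs y∈rs (sym y≡r))) , id ]′
    (x*y≡0⇒x≡0⊎y≡0 (begin
      (y - r) * horner t (quotient t as r) y
        ≡⟨ +-identityˡ _ ⟨
      0# + (y - r) * horner t (quotient t as r) y
        ≡⟨ cong (_+ (y - r) * horner t (quotient t as r) y) r-root ⟨
      horner t as r + (y - r) * horner t (quotient t as r) y
        ≡⟨ horner-division t as r y ⟨
      horner t as y
        ≡⟨ All.lookup rs-roots y∈rs ⟩
      0# ∎))

  horner0-vanishes : ∀ {d} (as : Vec Carrier d) {rs} → Unique rs → d ≤ length rs →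
                     All (λ r → horner 0# as r ≡ 0#) rs → ∀ x → horner 0# as x ≡ 0#
  horner0-vanishes []          _   _   _ x = refl
  horner0-vanishes as@(_ ∷ _) {r ∷ rs} rs!@(_ ∷ rs!′) (s≤s d≤rs) roots@(r-root ∷ _) x = begin
    horner 0# as x
      ≡⟨ horner-division 0# as r x ⟩
    horner 0# as r + (x - r) * horner 0# (quotient 0# as r) x
      ≡⟨ cong₂ (λ a b → a + (x - r) * b) r-root
               (horner0-vanishes (quotient 0# as r) rs!′ d≤rs (quotient-roots 0# as rs! roots) x) ⟩
    0# + (x - r) * 0#
      ≡⟨ trans (+-identityˡ _) (zeroʳ _) ⟩
    0# ∎

  horner1-roots≤ : ∀ {d} (as : Vec Carrier d) {rs} → Unique rs →
                   All (λ r → horner 1# as r ≡ 0#) rs → length rs ≤ d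
  horner1-roots≤ _          {[]}     _               _         = z≤n
  horner1-roots≤ []         {r ∷ rs} _               (1≡0 ∷ _) = contradiction 1≡0 1≢0
  horner1-roots≤ as@(_ ∷ _) {r ∷ rs} rs!@(_ ∷ rs!′) roots     =
    s≤s (horner1-roots≤ (quotient 1# as r) rs!′ (quotient-roots 1# as rs! roots))

  Degree<-vanishes : ∀ {d f} → Degree< d f → ∀ {rs} → Unique rs → d ≤ length rs →
                     All (λ r → f r ≡ 0#) rs → ∀ x → f x ≡ 0#
  Degree<-vanishes (as , f≗) rs! d≤rs roots x =
    trans (f≗ x) (horner0-vanishes as rs! d≤rs (All.map (λ {r} → trans (sym (f≗ r))) roots) x)

  Monic-roots≤ : ∀ {d f} → Monic d f → ∀ {rs} → Unique rs → All (λ r → f r ≡ 0#) rs → length rs ≤ d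
  Monic-roots≤ (as , f≗) rs! roots = horner1-roots≤ as rs! (All.map (λ {r} → trans (sym (f≗ r))) roots)

  Degree<-cong : ∀ {d f h} → (∀ x → f x ≡ h x) → Degree< d f → Degree< d h
  Degree<-cong f≗h (as , f≗) = as , λ x → trans (sym (f≗h x)) (f≗ x)

  horner-∷ʳ : ∀ {d} u (as : Vec Carrier d) x → horner 0# (as ∷ʳ u) x ≡ horner u as x
  horner-∷ʳ u []       x = trans (cong (u +_) (zeroʳ x)) (+-identityʳ u)
  horner-∷ʳ u (a ∷ as) x = cong (λ h → a + x * h) (horner-∷ʳ u as x)

  Monic⇒Degree< : ∀ {d f} → Monic d f → Degree< (suc d) f
  Monic⇒Degree< (as , f≗) = as ∷ʳ 1# , λ x → trans (f≗ x) (sym (horner-∷ʳ 1# as x))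

  Degree<-weaken : ∀ {d e f} → d ≤ e → Degree< d f → Degree< e f
  Degree<-weaken d≤e = weaken (ℕ.≤⇒≤′ d≤e)
    where
    weaken : ∀ {d e f} → d ℕ.≤′ e → Degree< d f → Degree< e f
    weaken ℕ.≤′-refl        F = F
    weaken (ℕ.≤′-step d≤′e) F with weaken d≤′e F
    ... | as , f≗ = as ∷ʳ 0# , λ x → trans (f≗ x) (sym (horner-∷ʳ 0# as x))

  horner-zipWith : ∀ {d} t (as bs : Vec Carrier d) x →
                   horner t (Vec.zipWith _+_ as bs) x ≡ horner t as x + horner 0# bs x
  horner-zipWith t []       []       x = sym (+-identityʳ t)
  horner-zipWith t (a ∷ as) (b ∷ bs) x = trans (cong (λ h → (a + b) + x * h) (horner-zipWith t as bs x))
    (solve 5 (λ a b x h k → (a :+ b) :+ x :* (h :+ k) := (a :+ x :* h) :+ (b :+ x :* k))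
             refl a b x (horner t as x) (horner 0# bs x))

  Degree<-+ : ∀ {d f h} → Degree< d f → Degree< d h → Degree< d (λ x → f x + h x)
  Degree<-+ (as , f≗) (bs , h≗) =
    Vec.zipWith _+_ as bs , λ x → trans (cong₂ _+_ (f≗ x) (h≗ x)) (sym (horner-zipWith 0# as bs x))

  Monic-+ : ∀ {d f h} → Monic d f → Degree< d h → Monic d (λ x → f x + h x)
  Monic-+ (as , f≗) (bs , h≗) =
    Vec.zipWith _+_ as bs , λ x → trans (cong₂ _+_ (f≗ x) (h≗ x)) (sym (horner-zipWith 1# as bs x))

  Degree<-0 : ∀ d → Degree< d (λ _ → 0#)
  Degree<-0 d = Vec.replicate d 0# , λ x → sym (horner-0 d x)
    where
    horner-0 : ∀ d x → horner 0# (Vec.replicate d 0#) x ≡ 0#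
    horner-0 zero    x = refl
    horner-0 (suc d) x = trans (cong (λ h → 0# + x * h) (horner-0 d x)) (trans (+-identityˡ _) (zeroʳ x))

  Degree<-∑ : ∀ {I : Set} {d} (xs : List I) (f : I → Carrier → Carrier) →
              (∀ i → Degree< d (f i)) → Degree< d (λ x → ∑ xs (λ i → f i x))
  Degree<-∑ {d = d} []       f _  = Degree<-0 d
  Degree<-∑         (i ∷ xs) f Fs = Degree<-+ (Fs i) (Degree<-∑ xs f Fs)

  Degree<-const : ∀ c → Degree< 1 (λ _ → c)
  Degree<-const c = (c ∷ []) , λ x → sym (trans (cong (c +_) (zeroʳ x)) (+-identityʳ c))

  Degree<-x* : ∀ {d f} → Degree< d f → Degree< (suc d) (λ x → x * f x)
  Degree<-x* (as , f≗) = 0# ∷ as , λ x → trans (cong (x *_) (f≗ x)) (sym (+-identityˡ _))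

  Degree<-c* : ∀ {d f} c → Degree< d f → Degree< d (λ x → c * f x)
  Degree<-c* c (as , f≗) = Vec.map (c *_) as , λ x → trans (cong (c *_) (f≗ x)) (sym (horner-map as x))
    where
    horner-map : ∀ {d} (as : Vec Carrier d) x → horner 0# (Vec.map (c *_) as) x ≡ c * horner 0# as x
    horner-map []       x = sym (zeroʳ c)
    horner-map (a ∷ as) x = trans (cong (λ h → c * a + x * h) (horner-map as x))
      (solve 4 (λ c a x h → c :* a :+ x :* (c :* h) := c :* (a :+ x :* h)) refl c a x (horner 0# as x))

  Degree<-[x+c]^ : ∀ c k → Degree< (suc k) (λ x → (x + c) ^ k)
  Degree<-[x+c]^ c zero    = Degree<-const 1#
  Degree<-[x+c]^ c (suc k) = Degree<-cong (λ x → sym (distribʳ ((x + c) ^ k) x c))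
    (Degree<-+ (Degree<-x* (Degree<-[x+c]^ c k))
               (Degree<-weaken (ℕ.n≤1+n _) (Degree<-c* c (Degree<-[x+c]^ c k))))

  Degree<-neg : Degree< 2 (λ x → - x)
  Degree<-neg = Degree<-cong (λ x → trans (cong (- 1# *_) (*-identityʳ x)) (-1*x≈-x x))
                             (Degree<-c* (- 1#) (Degree<-x* (Degree<-const 1#)))

  Monic-^ : ∀ m → Monic m (_^ m)
  Monic-^ m = Vec.replicate m 0# , λ x → sym (horner-^ m x)
    where
    horner-^ : ∀ m x → horner 1# (Vec.replicate m 0#) x ≡ x ^ m
    horner-^ zero    x = refl
    horner-^ (suc m) x = trans (+-identityˡ _) (cong (x *_) (horner-^ m x))

  -- Subfields

  subElement : ∀ Q {x} → InSub Q x → x ∈ subElements Q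
  subElement Q = ∈.∈-filter⁺ (λ x → (x ^ Q) ≟ x) (complete _)

  subElements-InSub : ∀ Q {x} → x ∈ subElements Q → InSub Q x
  subElements-InSub Q = proj₂ ∘ ∈.∈-filter⁻ (λ x → (x ^ Q) ≟ x) {xs = elements}

  subElements! : ∀ Q → Unique (subElements Q)
  subElements! Q = Unique.filter⁺ (λ x → (x ^ Q) ≟ x) unique

  trace : ℕ → ℕ → Carrier → Carrier
  trace Q zero    y = 0#
  trace Q (suc j) y = y ^ (Q ℕ.^ j) + trace Q j y

  module _ {Q} (Q-additive : Additive Q) (2≤Q : 2 ≤ Q) where

    private
      1≤Q : 1 ≤ Q
      1≤Q = ℕ.<⇒≤ 2≤Q

      1≤Q^ : ∀ j → 1 ≤ Q ℕ.^ j
      1≤Q^ j = ℕ.m^n>0 Q {{ℕ.>-nonZero 1≤Q}} j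

    trace-telescopes : ∀ j x → trace Q j (x ^ Q - x) ≡ x ^ (Q ℕ.^ j) - x
    trace-telescopes zero    x = trans (sym (-‿inverseʳ x)) (cong (_- x) (sym (*-identityʳ x)))
    trace-telescopes (suc j) x = begin
      (x ^ Q - x) ^ (Q ℕ.^ j) + trace Q j (x ^ Q - x)
        ≡⟨ cong₂ _+_ (additive-sub (1≤Q^ j) (additive-^ Q j Q-additive) (x ^ Q) x) (trace-telescopes j x) ⟩
      ((x ^ Q) ^ (Q ℕ.^ j) - x ^ (Q ℕ.^ j)) + (x ^ (Q ℕ.^ j) - x)
        ≡⟨ cong (λ y → (y - x ^ (Q ℕ.^ j)) + (x ^ (Q ℕ.^ j) - x)) (^-assocʳ x Q (Q ℕ.^ j)) ⟩
      (x ^ (Q ℕ.^ suc j) - x ^ (Q ℕ.^ j)) + (x ^ (Q ℕ.^ j) - x)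
        ≡⟨ solve 3 (λ a b x → (a :- b) :+ (b :- x) := a :- x) refl (x ^ (Q ℕ.^ suc j)) (x ^ (Q ℕ.^ j)) x ⟩
      x ^ (Q ℕ.^ suc j) - x ∎

    trace-monic : ∀ j → Monic (Q ℕ.^ j) (trace Q (suc j))
    trace-monic zero    = Monic-+ (Monic-^ 1) (Degree<-0 1)
    trace-monic (suc j) =
      Monic-+ (Monic-^ (Q ℕ.^ suc j)) (Degree<-weaken 1+Q^j≤Q^[1+j] (Monic⇒Degree< (trace-monic j)))
      where
      1+Q^j≤Q^[1+j] : suc (Q ℕ.^ j) ≤ Q ℕ.^ suc j
      1+Q^j≤Q^[1+j] = subst (suc (Q ℕ.^ j) ≤_) (ℕ.*-comm (Q ℕ.^ j) Q)
                            (ℕ.m<m*n (Q ℕ.^ j) Q {{ℕ.>-nonZero (1≤Q^ j)}} 2≤Q)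

    z^Q-z≡z₀^Q-z₀⇒InSub[z-z₀] : ∀ {z z₀} → z ^ Q - z ≡ z₀ ^ Q - z₀ → InSub Q (z - z₀)
    z^Q-z≡z₀^Q-z₀⇒InSub[z-z₀] {z} {z₀} eq = begin
      (z - z₀) ^ Q
        ≡⟨ additive-sub 1≤Q Q-additive z z₀ ⟩
      z ^ Q - z₀ ^ Q
        ≡⟨ solve 4 (λ a b z z₀ → a :- b := (a :- z) :+ z :- b) refl (z ^ Q) (z₀ ^ Q) z z₀ ⟩
      (z ^ Q - z) + z - z₀ ^ Q
        ≡⟨ cong (λ w → w + z - z₀ ^ Q) eq ⟩
      (z₀ ^ Q - z₀) + z - z₀ ^ Q
        ≡⟨ solve 3 (λ b z z₀ → (b :- z₀) :+ z :- b := z :- z₀) refl (z₀ ^ Q) z z₀ ⟩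
      z - z₀ ∎

    -- x ↦ x^Q - x maps F into the ≤ Q^(N-1) zeros of the trace, with fibres translates of F_Q.
    subElements-length≥ : ∀ {N} → 1 ≤ N → size ≡ Q ℕ.^ N → Q ≤ length (subElements Q)
    subElements-length≥ {suc N} _ size≡ =
      ℕ.*-cancelʳ-≤ Q (length (subElements Q)) (Q ℕ.^ N) {{ℕ.>-nonZero (1≤Q^ N)}}
        (subst₂ _≤_ size≡ (ℕ.*-comm (Q ℕ.^ N) _)
          (ℕ.≤-trans (bounded-fibres⇒length≤ _≟_ φ fibre-bound traceZeros unique φ[elements]⊆)
                     (ℕ.*-monoˡ-≤ _ traceZeros≤)))
      where
      φ : Carrier → Carrier
      φ x = x ^ Q - x
      traceZeros : List Carrier
      traceZeros = filter (λ y → trace Q (suc N) y ≟ 0#) elements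
      traceZeros≤ : length traceZeros ≤ Q ℕ.^ N
      traceZeros≤ = Monic-roots≤ (trace-monic N) (Unique.filter⁺ (λ y → trace Q (suc N) y ≟ 0#) unique)
                                 (All.all-filter (λ y → trace Q (suc N) y ≟ 0#) elements)
      φ[elements]⊆ : All (λ x → φ x ∈ traceZeros) elements
      φ[elements]⊆ = All.tabulate λ {x} _ → ∈.∈-filter⁺ (λ y → trace Q (suc N) y ≟ 0#) (complete (φ x))
        (trans (trace-telescopes (suc N) x)
               (trans (cong (λ s → x ^ s - x) (sym size≡)) (trans (cong (_- x) (x^size≡x x)) (-‿inverseʳ x))))
      fibre-bound : ∀ y {zs} → Unique zs → All (λ z → φ z ≡ y) zs → length zs ≤ length (subElements Q)
      fibre-bound y {[]}      _   _               = z≤n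
      fibre-bound y {z₀ ∷ zs} zs! fibre@(φz₀≡y ∷ _) =
        subst (_≤ length (subElements Q)) (List.length-map (_- z₀) (z₀ ∷ zs))
        (Unique∧⊆⇒length≤ (Unique.map⁺ (+-cancelʳ (- z₀) _ _) zs!) translates⊆)
        where
        translates⊆ : ∀ {w} → w ∈ map (_- z₀) (z₀ ∷ zs) → w ∈ subElements Q
        translates⊆ w∈ with ∈.∈-map⁻ (_- z₀) w∈
        ... | z , z∈ , refl = subElement Q (z^Q-z≡z₀^Q-z₀⇒InSub[z-z₀] (trans (All.lookup fibre z∈) (sym φz₀≡y)))

  module Subfield {q n} (q-additive : Additive q) (2≤q : 2 ≤ q) (1≤n : 1 ≤ n) (size≡qⁿ : size ≡ q ℕ.^ n) where

    K : List Carrier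
    K = subElements q

    private
      K! : Unique K
      K! = subElements! q

      1≤q : 1 ≤ q
      1≤q = ℕ.<⇒≤ 2≤q

      1+[q-1]≡q : suc (q ℕ.∸ 1) ≡ q
      1+[q-1]≡q = ℕ.suc-pred q {{ℕ.>-nonZero 1≤q}}

    x^q≡x*x^[q-1] : ∀ x → x ^ q ≡ x * x ^ (q ℕ.∸ 1)
    x^q≡x*x^[q-1] x = cong (x ^_) (sym 1+[q-1]≡q)

    InSub-0 : InSub q 0#
    InSub-0 = 0^≡0 1≤q

    InSub-1 : InSub q 1#
    InSub-1 = 1^n≡1 q

    InSub-+ : ∀ {x y} → InSub q x → InSub q y → InSub q (x + y)
    InSub-+ {x} {y} x∈K y∈K = trans (q-additive x y) (cong₂ _+_ x∈K y∈K)

    InSub-neg : ∀ {x} → InSub q x → InSub q (- x)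
    InSub-neg {x} x∈K = trans (additive-neg 1≤q q-additive x) (cong -_ x∈K)

    InSub-* : ∀ {x y} → InSub q x → InSub q y → InSub q (x * y)
    InSub-* {x} {y} x∈K y∈K = trans (^-distrib-* x y q) (cong₂ _*_ x∈K y∈K)

    InSub-⁻¹ : ∀ {x} → x ≢ 0# → InSub q x → InSub q (x ⁻¹)
    InSub-⁻¹ {x} x≢0 x∈K = trans (sym (⁻¹-^ q x≢0)) (cong _⁻¹ x∈K)

    InSub⇒^[q-1]≡1 : ∀ {x} → InSub q x → x ≢ 0# → x ^ (q ℕ.∸ 1) ≡ 1#
    InSub⇒^[q-1]≡1 {x} x∈K x≢0 = *-cancelˡ x≢0 (trans (sym (x^q≡x*x^[q-1] x)) (trans x∈K (sym (*-identityʳ x))))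

    [s+c]^q≡s^q+c : ∀ s {c} → InSub q c → (s + c) ^ q ≡ s ^ q + c
    [s+c]^q≡s^q+c s {c} c∈K = trans (q-additive s c) (cong (s ^ q +_) c∈K)

    K-translate : ∀ {d} → InSub q d → ∀ f → ∑ K (λ c → f (d + c)) ≡ ∑ K f
    K-translate {d} d∈K = ∑-reindex (d +_) (_- d) K!
      (λ c∈K → subElement q (InSub-+ d∈K (subElements-InSub q c∈K)))
      (λ c∈K → subElement q (InSub-+ (subElements-InSub q c∈K) (InSub-neg d∈K)))
      (λ c → solve 2 (λ d c → d :+ (c :- d) := c) refl d c)
      (λ c → solve 2 (λ d c → (d :+ c) :- d := c) refl d c)

    ∑K-const≡0 : ∀ c → ∑ K (λ _ → c) ≡ 0#
    ∑K-const≡0 c = begin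
      ∑ K (λ _ → c)            ≡⟨ ∑-const K c ⟩
      length K · c             ≡⟨ cong (length K ·_) (*-identityˡ c) ⟨
      length K · (1# * c)      ≡⟨ ×-assoc-* (length K) 1# c ⟨
      (length K · 1#) * c      ≡⟨ cong (_* c) length-K·1≡0 ⟩
      0# * c                   ≡⟨ zeroˡ c ⟩
      0#                       ∎
      where
      length-K·1≡0 : length K · 1# ≡ 0#
      length-K·1≡0 = translation-closed⇒length·≡0 1# K!
        (λ c∈K → subElement q (InSub-+ (subElements-InSub q c∈K) InSub-1))
        (λ c∈K → subElement q (InSub-+ (subElements-InSub q c∈K) (InSub-neg InSub-1)))

    ∑K[1-f]≡-∑Kf : ∀ f → ∑ K (λ c → 1# - f c) ≡ - ∑ K f
    ∑K[1-f]≡-∑Kf f = begin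
      ∑ K (λ c → 1# - f c)                 ≡⟨ ∑-distrib-+ K (λ _ → 1#) (λ c → - f c) ⟩
      ∑ K (λ _ → 1#) + ∑ K (λ c → - f c)   ≡⟨ cong₂ _+_ (∑K-const≡0 1#) (∑-neg K f) ⟩
      0# + - ∑ K f                         ≡⟨ +-identityˡ _ ⟩
      - ∑ K f                              ∎

    ∑K-of-indicator≡-1 : ∀ f → f 0# ≡ 0# → (∀ {c} → InSub q c → c ≢ 0# → f c ≡ 1#) → ∑ K f ≡ - 1#
    ∑K-of-indicator≡-1 f f0≡0 f≡1 = trans (sym (-‿involutive _)) (cong -_ (begin
      - ∑ K f                ≡⟨ ∑K[1-f]≡-∑Kf f ⟨
      ∑ K (λ c → 1# - f c)   ≡⟨ ∑-single K! (subElement q InSub-0) 1-f-vanishes ⟩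
      1# - f 0#              ≡⟨ cong (λ z → 1# - z) f0≡0 ⟩
      1# - 0#                ≡⟨ trans (cong (1# +_) -0#≈0#) (+-identityʳ 1#) ⟩
      1#                     ∎))
      where
      1-f-vanishes : ∀ {c} → c ∈ K → c ≢ 0# → 1# - f c ≡ 0#
      1-f-vanishes c∈K c≢0 = trans (cong (λ z → 1# - z) (f≡1 (subElements-InSub q c∈K) c≢0)) (-‿inverseʳ 1#)

    ∑K-g≡-1 : ∑ K (g q) ≡ - 1#
    ∑K-g≡-1 = ∑K-of-indicator≡-1 (g q) (g-0 q)
      (λ c∈K c≢0 → trans (g[x]≡[x^[q-1]]⁻¹ q c≢0) (trans (cong _⁻¹ (InSub⇒^[q-1]≡1 c∈K c≢0)) 1⁻¹≡1))

    -- s ↦ Σ_{c∈K} (s + c)^(q-1) + 1 has degree < q and vanishes on the ≥ q points of K.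
    ∑K-[s+c]^[q-1]≡-1 : ∀ s → ∑ K (λ c → (s + c) ^ (q ℕ.∸ 1)) ≡ - 1#
    ∑K-[s+c]^[q-1]≡-1 s = x+y≡0⇒x≡-y (Degree<-vanishes P-degree K! q≤|K| P-roots s)
      where
      P : Carrier → Carrier
      P s = ∑ K (λ c → (s + c) ^ (q ℕ.∸ 1)) + 1#
      P-degree : Degree< q P
      P-degree = Degree<-+
        (Degree<-∑ K (λ c x → (x + c) ^ (q ℕ.∸ 1)) λ c →
          subst (λ d → Degree< d (λ x → (x + c) ^ (q ℕ.∸ 1))) 1+[q-1]≡q (Degree<-[x+c]^ c (q ℕ.∸ 1)))
        (Degree<-weaken 1≤q (Degree<-const 1#))
      q≤|K| : q ≤ length K
      q≤|K| = subElements-length≥ q-additive 2≤q 1≤n size≡qⁿ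
      ∑K-^[q-1]≡-1 : ∑ K (_^ (q ℕ.∸ 1)) ≡ - 1#
      ∑K-^[q-1]≡-1 = ∑K-of-indicator≡-1 _ (0^≡0 (ℕ.∸-monoˡ-≤ 1 2≤q)) InSub⇒^[q-1]≡1
      P-roots : All (λ s → P s ≡ 0#) K
      P-roots = All.tabulate λ s∈K →
        trans (cong (_+ 1#) (trans (K-translate (subElements-InSub q s∈K) (_^ (q ℕ.∸ 1))) ∑K-^[q-1]≡-1))
              (-‿inverseˡ 1#)

    ¬InSub⇒x^q-x≢0 : ∀ {x} → ¬ InSub q x → x ^ q - x ≢ 0#
    ¬InSub⇒x^q-x≢0 x∉K = x∉K ∘ x-y≡0⇒x≡y

    ∑K-[s+c]⁻¹ : ∀ {s} → ¬ InSub q s → ∑ K (λ c → (s + c) ⁻¹) ≡ - ((s ^ q - s) ⁻¹)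
    ∑K-[s+c]⁻¹ {s} s∉K = begin
      ∑ K (λ c → (s + c) ⁻¹)
        ≡⟨ ∑-cong K (λ c∈K → [s+c]⁻¹≡ (subElements-InSub q c∈K)) ⟩
      ∑ K (λ c → V ⁻¹ * ((s + c) ^ (q ℕ.∸ 1) - 1#))
        ≡⟨ *-distribˡ-∑ (V ⁻¹) K _ ⟩
      V ⁻¹ * ∑ K (λ c → (s + c) ^ (q ℕ.∸ 1) - 1#)
        ≡⟨ cong (V ⁻¹ *_) (∑-distrib-+ K _ _) ⟩
      V ⁻¹ * (∑ K (λ c → (s + c) ^ (q ℕ.∸ 1)) + ∑ K (λ _ → - 1#))
        ≡⟨ cong₂ (λ a b → V ⁻¹ * (a + b)) (∑K-[s+c]^[q-1]≡-1 s) (∑K-const≡0 (- 1#)) ⟩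
      V ⁻¹ * (- 1# + 0#)
        ≡⟨ cong (V ⁻¹ *_) (+-identityʳ _) ⟩
      V ⁻¹ * - 1#
        ≡⟨ -‿distribʳ-* _ _ ⟨
      - (V ⁻¹ * 1#)
        ≡⟨ cong -_ (*-identityʳ _) ⟩
      - (V ⁻¹) ∎
      where
      V = s ^ q - s
      [s+c]⁻¹≡ : ∀ {c} → InSub q c → (s + c) ⁻¹ ≡ V ⁻¹ * ((s + c) ^ (q ℕ.∸ 1) - 1#)
      [s+c]⁻¹≡ {c} c∈K = sym (⁻¹-unique (begin
        z * (V ⁻¹ * (z ^ (q ℕ.∸ 1) - 1#))
          ≡⟨ solve 4 (λ z w a o → z :* (w :* (a :- o)) := (z :* a :- z :* o) :* w) refl z (V ⁻¹) (z ^ (q ℕ.∸ 1)) 1# ⟩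
        (z * z ^ (q ℕ.∸ 1) - z * 1#) * V ⁻¹
          ≡⟨ cong₂ (λ a b → (a - b) * V ⁻¹) (sym (x^q≡x*x^[q-1] z)) (*-identityʳ z) ⟩
        (z ^ q - z) * V ⁻¹
          ≡⟨ cong (λ a → (a - z) * V ⁻¹) ([s+c]^q≡s^q+c s c∈K) ⟩
        (s ^ q + c - (s + c)) * V ⁻¹
          ≡⟨ cong (_* V ⁻¹) (solve 3 (λ a s c → a :+ c :- (s :+ c) := a :- s) refl (s ^ q) s c) ⟩
        V * V ⁻¹
          ≡⟨ inverseʳ V (¬InSub⇒x^q-x≢0 s∉K) ⟩
        1# ∎))
        where z = s + c

    g≡x*[x^q]⁻¹ : ∀ {x} → x ≢ 0# → g q x ≡ x * (x ^ q) ⁻¹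
    g≡x*[x^q]⁻¹ {x} x≢0 = begin
      g q x                               ≡⟨ g[x]≡[x^[q-1]]⁻¹ q x≢0 ⟩
      (x ^ (q ℕ.∸ 1)) ⁻¹                  ≡⟨ x*[x⁻¹*y]≡y x≢0 _ ⟨
      x * (x ⁻¹ * (x ^ (q ℕ.∸ 1)) ⁻¹)     ≡⟨ cong (x *_) (⁻¹-distrib-* x≢0 (^-≢0 (q ℕ.∸ 1) x≢0)) ⟨
      x * (x * x ^ (q ℕ.∸ 1)) ⁻¹          ≡⟨ cong (λ y → x * y ⁻¹) (x^q≡x*x^[q-1] x) ⟨
      x * (x ^ q) ⁻¹                      ∎

    h : Carrier → Carrier
    h t = ∑ K (λ c → g q (t + c))

    h-InSub : ∀ {t} → InSub q t → h t ≡ - 1#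
    h-InSub t∈K = trans (K-translate t∈K (g q)) ∑K-g≡-1

    -- For c ∈ K, g(t + c) = (t + c) / (t + c)^q = 1 - W / (t^q + c) with W = t^q - t.
    h-¬InSub : ∀ {t} → ¬ InSub q t → h t ≡ g q (t ^ q - t)
    h-¬InSub {t} t∉K = begin
      ∑ K (λ c → g q (t + c))                 ≡⟨ ∑-cong K (λ c∈K → g[t+c]≡ (subElements-InSub q c∈K)) ⟩
      ∑ K (λ c → 1# - W * (s + c) ⁻¹)         ≡⟨ ∑K[1-f]≡-∑Kf _ ⟩
      - ∑ K (λ c → W * (s + c) ⁻¹)            ≡⟨ cong -_ (*-distribˡ-∑ W K _) ⟩
      - (W * ∑ K (λ c → (s + c) ⁻¹))          ≡⟨ cong (λ y → - (W * y)) (∑K-[s+c]⁻¹ s∉K) ⟩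
      - (W * - ((s ^ q - s) ⁻¹))              ≡⟨ cong -_ (-‿distribʳ-* W _) ⟨
      - - (W * (s ^ q - s) ⁻¹)                ≡⟨ -‿involutive _ ⟩
      W * (s ^ q - s) ⁻¹                      ≡⟨ cong (λ y → W * y ⁻¹) W^q≡s^q-s ⟨
      W * (W ^ q) ⁻¹                          ≡⟨ g≡x*[x^q]⁻¹ W≢0 ⟨
      g q W                                   ∎
      where
      s = t ^ q
      W = t ^ q - t
      W≢0 : W ≢ 0#
      W≢0 = ¬InSub⇒x^q-x≢0 t∉K
      W^q≡s^q-s : W ^ q ≡ s ^ q - s
      W^q≡s^q-s = additive-sub 1≤q q-additive (t ^ q) t
      s∉K : ¬ InSub q s
      s∉K s∈K = W≢0 (^≡0⇒≡0 q (trans W^q≡s^q-s (trans (cong (_- s) s∈K) (-‿inverseʳ s))))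
      g[t+c]≡ : ∀ {c} → InSub q c → g q (t + c) ≡ 1# - W * (s + c) ⁻¹
      g[t+c]≡ {c} c∈K = begin
        g q (t + c)
          ≡⟨ g≡x*[x^q]⁻¹ t+c≢0 ⟩
        (t + c) * ((t + c) ^ q) ⁻¹
          ≡⟨ cong (λ y → (t + c) * y ⁻¹) ([s+c]^q≡s^q+c t c∈K) ⟩
        (t + c) * (s + c) ⁻¹
          ≡⟨ cong (_* (s + c) ⁻¹) (solve 3 (λ t s c → t :+ c := (s :+ c) :- (s :- t)) refl t s c) ⟩
        ((s + c) - W) * (s + c) ⁻¹
          ≡⟨ solve 3 (λ a w i → (a :- w) :* i := a :* i :- w :* i) refl (s + c) W ((s + c) ⁻¹) ⟩
        (s + c) * (s + c) ⁻¹ - W * (s + c) ⁻¹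
          ≡⟨ cong (λ y → y - W * (s + c) ⁻¹) (inverseʳ (s + c) s+c≢0) ⟩
        1# - W * (s + c) ⁻¹ ∎
        where
        t+c≢0 : t + c ≢ 0#
        t+c≢0 t+c≡0 = t∉K (subst (InSub q) (sym (x+y≡0⇒x≡-y t+c≡0)) (InSub-neg c∈K))
        s+c≢0 : s + c ≢ 0#
        s+c≢0 s+c≡0 = t+c≢0 (^≡0⇒≡0 q (trans ([s+c]^q≡s^q+c t c∈K) s+c≡0))

    h≢0 : ∀ t → h t ≢ 0#
    h≢0 t with (t ^ q) ≟ t
    ... | yes t∈K = subst (_≢ 0#) (sym (h-InSub t∈K)) -1≢0
    ... | no  t∉K = subst (_≢ 0#) (sym (h-¬InSub t∉K)) (g≢0 q (¬InSub⇒x^q-x≢0 t∉K))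

    ∑K-g-affine : ∀ a {b} → b ≢ 0# → ∑ K (λ c → g q (a + c * b)) ≡ g q b * h (a * b ⁻¹)
    ∑K-g-affine a {b} b≢0 = begin
      ∑ K (λ c → g q (a + c * b))               ≡⟨ ∑-cong K (λ {c} _ → cong (g q) (a+cb≡ c)) ⟩
      ∑ K (λ c → g q (b * (a * b ⁻¹ + c)))      ≡⟨ ∑-cong K (λ _ → g-homo-* q b _) ⟩
      ∑ K (λ c → g q b * g q (a * b ⁻¹ + c))    ≡⟨ *-distribˡ-∑ (g q b) K _ ⟩
      g q b * h (a * b ⁻¹)                      ∎
      where
      a+cb≡ : ∀ c → a + c * b ≡ b * (a * b ⁻¹ + c)
      a+cb≡ c = begin
        a + c * b
          ≡⟨ cong (λ y → y + c * b) (*-identityʳ a) ⟨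
        a * 1# + c * b
          ≡⟨ cong (λ y → a * y + c * b) (inverseʳ b b≢0) ⟨
        a * (b * b ⁻¹) + c * b
          ≡⟨ solve 4 (λ a b i c → a :* (b :* i) :+ c :* b := b :* (a :* i :+ c)) refl a b (b ⁻¹) c ⟩
        b * (a * b ⁻¹ + c) ∎

    sumFree₁ : SumFree q 1 (g q)
    sumFree₁ a (b ∷ []) indep Σ≡0 =
      *-≢0 (g≢0 q b≢0) (h≢0 (a * b ⁻¹)) (trans (sym (trans (affineSum-1 q (g q) a b) (∑K-g-affine a b≢0))) Σ≡0)
      where
      b≢0 : b ≢ 0#
      b≢0 b≡0 with indep (1# ∷ []) (InSub-1 ∷ []) lin≡0
        where
        lin≡0 : 1# * b + 0# ≡ 0#
        lin≡0 = trans (cong (λ y → 1# * y + 0#) b≡0) (trans (+-identityʳ _) (zeroʳ 1#))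
      ... | 1≡0 ∷ [] = 1≢0 1≡0

    J : Carrier → Carrier → Carrier
    J α β = ∑ K (λ c → h (α + c * β))

    affineSum≡g*J : ∀ a b₁ {b₂} → b₂ ≢ 0# →
                    affineSum q (g q) a (b₁ ∷ b₂ ∷ []) ≡ g q b₂ * J (a * b₂ ⁻¹) (b₁ * b₂ ⁻¹)
    affineSum≡g*J a b₁ {b₂} b₂≢0 = begin
      affineSum q (g q) a (b₁ ∷ b₂ ∷ [])
        ≡⟨ affineSum-2 q (g q) a b₁ b₂ ⟩
      ∑ K (λ c₁ → ∑ K (λ c₂ → g q ((a + c₁ * b₁) + c₂ * b₂)))
        ≡⟨ ∑-cong K (λ {c₁} _ → ∑K-g-affine (a + c₁ * b₁) b₂≢0) ⟩
      ∑ K (λ c₁ → g q b₂ * h ((a + c₁ * b₁) * b₂ ⁻¹))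
        ≡⟨ ∑-cong K (λ {c₁} _ → cong (λ y → g q b₂ * h y)
             (solve 4 (λ a c b i → (a :+ c :* b) :* i := a :* i :+ c :* (b :* i)) refl a c₁ b₁ (b₂ ⁻¹))) ⟩
      ∑ K (λ c₁ → g q b₂ * h (a * b₂ ⁻¹ + c₁ * (b₁ * b₂ ⁻¹)))
        ≡⟨ *-distribˡ-∑ (g q b₂) K _ ⟩
      g q b₂ * J (a * b₂ ⁻¹) (b₁ * b₂ ⁻¹) ∎

    χK : Carrier → Carrier
    χK t with (t ^ q) ≟ t
    ... | yes _ = 1#
    ... | no  _ = 0#

    χK-InSub : ∀ {t} → InSub q t → χK t ≡ 1#
    χK-InSub {t} t∈K with (t ^ q) ≟ t
    ... | yes _   = refl
    ... | no  t∉K = contradiction t∈K t∉K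

    χK-¬InSub : ∀ {t} → ¬ InSub q t → χK t ≡ 0#
    χK-¬InSub {t} t∉K with (t ^ q) ≟ t
    ... | yes t∈K = contradiction t∈K t∉K
    ... | no  _   = refl

    h≡g-χK : ∀ t → h t ≡ g q (t ^ q - t) - χK t
    h≡g-χK t with (t ^ q) ≟ t
    ... | yes t∈K = begin
      h t                        ≡⟨ h-InSub t∈K ⟩
      - 1#                       ≡⟨ +-identityˡ _ ⟨
      0# - 1#                    ≡⟨ cong (_- 1#) (g-0 q) ⟨
      g q 0# - 1#                ≡⟨ cong (λ y → g q y - 1#) (trans (cong (_- t) t∈K) (-‿inverseʳ t)) ⟨
      g q (t ^ q - t) - 1#       ∎
    ... | no  t∉K = begin
      h t                        ≡⟨ h-¬InSub t∉K ⟩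
      g q (t ^ q - t)            ≡⟨ +-identityʳ _ ⟨
      g q (t ^ q - t) + 0#       ≡⟨ cong (g q (t ^ q - t) +_) -0#≈0# ⟨
      g q (t ^ q - t) - 0#       ∎

    ^q-affine : ∀ α β {c} → InSub q c → (α + c * β) ^ q - (α + c * β) ≡ (α ^ q - α) + c * (β ^ q - β)
    ^q-affine α β {c} c∈K = begin
      (α + c * β) ^ q - (α + c * β)
        ≡⟨ cong (_- (α + c * β)) (q-additive α (c * β)) ⟩
      (α ^ q + (c * β) ^ q) - (α + c * β)
        ≡⟨ cong (λ y → (α ^ q + y) - (α + c * β)) (trans (^-distrib-* c β q) (cong (_* β ^ q) c∈K)) ⟩
      (α ^ q + c * β ^ q) - (α + c * β)
        ≡⟨ solve 5 (λ A a c B b → (A :+ c :* B) :- (a :+ c :* b) := (A :- a) :+ c :* (B :- b))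
                   refl (α ^ q) α c (β ^ q) β ⟩
      (α ^ q - α) + c * (β ^ q - β) ∎

    J≡ : ∀ α {β} → ¬ InSub q β →
         J α β ≡ g q (β ^ q - β) * h ((α ^ q - α) * (β ^ q - β) ⁻¹) - ∑ K (λ c → χK (α + c * β))
    J≡ α {β} β∉K = begin
      ∑ K (λ c → h (α + c * β))
        ≡⟨ ∑-cong K (λ {c} _ → h≡g-χK (α + c * β)) ⟩
      ∑ K (λ c → g q ((α + c * β) ^ q - (α + c * β)) - χK (α + c * β))
        ≡⟨ ∑-distrib-+ K _ _ ⟩
      ∑ K (λ c → g q ((α + c * β) ^ q - (α + c * β))) + ∑ K (λ c → - χK (α + c * β))
        ≡⟨ cong₂ _+_ (∑-cong K (λ c∈K → cong (g q) (^q-affine α β (subElements-InSub q c∈K)))) (∑-neg K _) ⟩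
      ∑ K (λ c → g q ((α ^ q - α) + c * (β ^ q - β))) - ∑ K (λ c → χK (α + c * β))
        ≡⟨ cong (_- ∑ K (λ c → χK (α + c * β))) (∑K-g-affine (α ^ q - α) (¬InSub⇒x^q-x≢0 β∉K)) ⟩
      g q (β ^ q - β) * h ((α ^ q - α) * (β ^ q - β) ⁻¹) - ∑ K (λ c → χK (α + c * β)) ∎

    line-meets-K-once : ∀ {α β c c′} → ¬ InSub q β → InSub q c → InSub q c′ →
                        InSub q (α + c * β) → InSub q (α + c′ * β) → c ≡ c′
    line-meets-K-once {α} {β} {c} {c′} β∉K c∈K c′∈K P P′ with c ≟ c′
    ... | yes c≡c′ = c≡c′
    ... | no  c≢c′ =
      contradiction (subst (InSub q) (sym β≡) (InSub-* (InSub-+ P (InSub-neg P′)) (InSub-⁻¹ d≢0 d∈K))) β∉K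
      where
      d = c - c′
      d≢0 = x≢y⇒x-y≢0 c≢c′
      d∈K = InSub-+ c∈K (InSub-neg c′∈K)
      β≡ : β ≡ ((α + c * β) - (α + c′ * β)) * d ⁻¹
      β≡ = begin
        β
          ≡⟨ *-identityʳ β ⟨
        β * 1#
          ≡⟨ cong (β *_) (inverseʳ d d≢0) ⟨
        β * (d * d ⁻¹)
          ≡⟨ solve 5 (λ a b c c′ i → b :* ((c :- c′) :* i) := ((a :+ c :* b) :- (a :+ c′ :* b)) :* i)
                     refl α β c c′ (d ⁻¹) ⟩
        ((α + c * β) - (α + c′ * β)) * d ⁻¹ ∎

    J-line-meets-K : ∀ α {β c} → ¬ InSub q β → InSub q c → InSub q (α + c * β) →
                     J α β ≡ - g q (β ^ q - β) - 1#
    J-line-meets-K α {β} {c} β∉K c∈K P = begin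
      J α β
        ≡⟨ J≡ α β∉K ⟩
      g q B * h (A * B ⁻¹) - ∑ K (λ c → χK (α + c * β))
        ≡⟨ cong₂ (λ x y → g q B * x - y) (h-InSub A*B⁻¹∈K) ∑χK≡1 ⟩
      g q B * - 1# - 1#
        ≡⟨ cong (_- 1#) (trans (sym (-‿distribʳ-* _ _)) (cong -_ (*-identityʳ _))) ⟩
      - g q B - 1# ∎
      where
      A = α ^ q - α
      B = β ^ q - β
      A≡-cB : A ≡ - (c * B)
      A≡-cB = x+y≡0⇒x≡-y (trans (sym (^q-affine α β c∈K)) (trans (cong (_- (α + c * β)) P) (-‿inverseʳ _)))
      A*B⁻¹∈K : InSub q (A * B ⁻¹)
      A*B⁻¹∈K = subst (InSub q) (sym (begin
        A * B ⁻¹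
          ≡⟨ cong (_* B ⁻¹) A≡-cB ⟩
        - (c * B) * B ⁻¹
          ≡⟨ solve 3 (λ c b i → :- (c :* b) :* i := :- (c :* (b :* i))) refl c B (B ⁻¹) ⟩
        - (c * (B * B ⁻¹))
          ≡⟨ cong (λ y → - (c * y)) (inverseʳ B (¬InSub⇒x^q-x≢0 β∉K)) ⟩
        - (c * 1#)
          ≡⟨ cong -_ (*-identityʳ c) ⟩
        - c ∎)) (InSub-neg c∈K)
      ∑χK≡1 : ∑ K (λ c → χK (α + c * β)) ≡ 1#
      ∑χK≡1 = trans (∑-single K! (subElement q c∈K)
                (λ c′∈K c′≢c → χK-¬InSub (λ P′ → c′≢c (line-meets-K-once β∉K (subElements-InSub q c′∈K) c∈K P′ P))))
              (χK-InSub P)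

    J-line-misses-K : ∀ α {β} → ¬ InSub q β → (∀ {c} → InSub q c → ¬ InSub q (α + c * β)) →
                      J α β ≡ g q (β ^ q - β) * h ((α ^ q - α) * (β ^ q - β) ⁻¹)
    J-line-misses-K α {β} β∉K none = begin
      J α β
        ≡⟨ J≡ α β∉K ⟩
      g q B * h (A * B ⁻¹) - ∑ K (λ c → χK (α + c * β))
        ≡⟨ cong (λ y → g q B * h (A * B ⁻¹) - y) (∑-zero K (λ c∈K → χK-¬InSub (none (subElements-InSub q c∈K)))) ⟩
      g q B * h (A * B ⁻¹) - 0#
        ≡⟨ trans (cong (g q B * h (A * B ⁻¹) +_) -0#≈0#) (+-identityʳ _) ⟩
      g q B * h (A * B ⁻¹) ∎
      where
      A = α ^ q - α
      B = β ^ q - β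

    g≡-1⇒^q≡- : ∀ {x} → x ≢ 0# → g q x ≡ - 1# → x ^ q ≡ - x
    g≡-1⇒^q≡- {x} x≢0 gx≡-1 = begin
      x ^ q                     ≡⟨ x^q≡x*x^[q-1] x ⟩
      x * x ^ (q ℕ.∸ 1)         ≡⟨ cong (x *_) x^[q-1]≡-1 ⟩
      x * - 1#                  ≡⟨ -‿distribʳ-* x 1# ⟨
      - (x * 1#)                ≡⟨ cong -_ (*-identityʳ x) ⟩
      - x                       ∎
      where
      x^[q-1]≡-1 : x ^ (q ℕ.∸ 1) ≡ - 1#
      x^[q-1]≡-1 = begin
        x ^ (q ℕ.∸ 1)                 ≡⟨ ⁻¹-unique (inverseˡ (^-≢0 (q ℕ.∸ 1) x≢0)) ⟩
        ((x ^ (q ℕ.∸ 1)) ⁻¹) ⁻¹       ≡⟨ cong _⁻¹ (trans (sym (g[x]≡[x^[q-1]]⁻¹ q x≢0)) gx≡-1) ⟩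
        (- 1#) ⁻¹                     ≡⟨ -1⁻¹≡-1 ⟩
        - 1#                          ∎

    ^q≡-⇒g≡-1 : ∀ {x} → x ≢ 0# → x ^ q ≡ - x → g q x ≡ - 1#
    ^q≡-⇒g≡-1 {x} x≢0 x^q≡-x = trans (g[x]≡[x^[q-1]]⁻¹ q x≢0) (trans (cong _⁻¹ x^[q-1]≡-1) -1⁻¹≡-1)
      where
      x^[q-1]≡-1 : x ^ (q ℕ.∸ 1) ≡ - 1#
      x^[q-1]≡-1 = *-cancelˡ x≢0 (trans (sym (x^q≡x*x^[q-1] x))
                                 (trans x^q≡-x (trans (cong -_ (sym (*-identityʳ x))) (-‿distribʳ-* x 1#))))

    [x^q-x]^q≡[x^q]^q-x^q : ∀ x → (x ^ q - x) ^ q ≡ (x ^ q) ^ q - x ^ q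
    [x^q-x]^q≡[x^q]^q-x^q x = additive-sub 1≤q q-additive (x ^ q) x

    [x^q]^q≡x⇒[x^q-x]^q≡- : ∀ {x} → (x ^ q) ^ q ≡ x → (x ^ q - x) ^ q ≡ - (x ^ q - x)
    [x^q]^q≡x⇒[x^q-x]^q≡- {x} x^q^q≡x = begin
      (x ^ q - x) ^ q          ≡⟨ [x^q-x]^q≡[x^q]^q-x^q x ⟩
      (x ^ q) ^ q - x ^ q      ≡⟨ cong (_- x ^ q) x^q^q≡x ⟩
      x - x ^ q                ≡⟨ solve 2 (λ x y → x :- y := :- (y :- x)) refl x (x ^ q) ⟩
      - (x ^ q - x)            ∎

    [x^q-x]^q≡-⇒[x^q]^q≡x : ∀ {x} → (x ^ q - x) ^ q ≡ - (x ^ q - x) → (x ^ q) ^ q ≡ x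
    [x^q-x]^q≡-⇒[x^q]^q≡x {x} B^q≡-B = begin
      (x ^ q) ^ q
        ≡⟨ solve 2 (λ z y → z := (z :- y) :+ y) refl ((x ^ q) ^ q) (x ^ q) ⟩
      ((x ^ q) ^ q - x ^ q) + x ^ q
        ≡⟨ cong (_+ x ^ q) (trans (sym ([x^q-x]^q≡[x^q]^q-x^q x)) B^q≡-B) ⟩
      - (x ^ q - x) + x ^ q
        ≡⟨ solve 2 (λ x y → :- (y :- x) :+ y := x) refl x (x ^ q) ⟩
      x ∎

    [x^q]^q≡x⇒x^q^[k*2]≡x : ∀ {x} → (x ^ q) ^ q ≡ x → ∀ k → x ^ (q ℕ.^ (k ℕ.* 2)) ≡ x
    [x^q]^q≡x⇒x^q^[k*2]≡x {x} x^q^q≡x zero    = *-identityʳ x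
    [x^q]^q≡x⇒x^q^[k*2]≡x {x} x^q^q≡x (suc k) = begin
      x ^ (q ℕ.* (q ℕ.* r))      ≡⟨ ^-assocʳ x q (q ℕ.* r) ⟨
      (x ^ q) ^ (q ℕ.* r)        ≡⟨ ^-assocʳ (x ^ q) q r ⟨
      ((x ^ q) ^ q) ^ r          ≡⟨ cong (_^ r) x^q^q≡x ⟩
      x ^ r                      ≡⟨ [x^q]^q≡x⇒x^q^[k*2]≡x x^q^q≡x k ⟩
      x                          ∎
      where r = q ℕ.^ (k ℕ.* 2)

    odd⇒[x^q]^q≡x⇒InSub : Odd n → ∀ {x} → (x ^ q) ^ q ≡ x → InSub q x
    odd⇒[x^q]^q≡x⇒InSub n-odd {x} x^q^q≡x = begin
      x ^ q                            ≡⟨ [x^q]^q≡x⇒x^q^[k*2]≡x (cong (_^ q) x^q^q≡x) (n / 2) ⟨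
      (x ^ q) ^ (q ℕ.^ (n / 2 ℕ.* 2))  ≡⟨ ^-assocʳ x q _ ⟩
      x ^ (q ℕ.^ suc (n / 2 ℕ.* 2))    ≡⟨ cong (λ k → x ^ (q ℕ.^ k)) (n%2≡1⇒n≡1+[n/2]*2 n n-odd) ⟨
      x ^ (q ℕ.^ n)                    ≡⟨ cong (x ^_) size≡qⁿ ⟨
      x ^ size                         ≡⟨ x^size≡x x ⟩
      x                                ∎

    LinIndep⇒≢0 : ∀ {b₁ b₂} → LinIndep q (b₁ ∷ b₂ ∷ []) → b₂ ≢ 0#
    LinIndep⇒≢0 {b₁} {b₂} indep b₂≡0 with indep (0# ∷ 1# ∷ []) (InSub-0 ∷ InSub-1 ∷ []) lin≡0
      where
      lin≡0 : 0# * b₁ + (1# * b₂ + 0#) ≡ 0#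
      lin≡0 = trans (cong₂ (λ x y → x + (1# * y + 0#)) (zeroˡ b₁) b₂≡0)
                    (trans (+-identityˡ _) (trans (+-identityʳ _) (zeroʳ 1#)))
    ... | _ ∷ 1≡0 ∷ [] = 1≢0 1≡0

    LinIndep⇒¬InSub : ∀ {b₁ b₂} → LinIndep q (b₁ ∷ b₂ ∷ []) → ¬ InSub q (b₁ * b₂ ⁻¹)
    LinIndep⇒¬InSub {b₁} {b₂} indep β∈K with indep (1# ∷ - (b₁ * b₂ ⁻¹) ∷ []) (InSub-1 ∷ InSub-neg β∈K ∷ []) lin≡0
      where
      lin≡0 : 1# * b₁ + (- (b₁ * b₂ ⁻¹) * b₂ + 0#) ≡ 0#
      lin≡0 = begin
        1# * b₁ + (- (b₁ * b₂ ⁻¹) * b₂ + 0#)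
          ≡⟨ cong (1# * b₁ +_) (+-identityʳ _) ⟩
        1# * b₁ + - (b₁ * b₂ ⁻¹) * b₂
          ≡⟨ solve 4 (λ o b₁ b₂ i → o :* b₁ :+ :- (b₁ :* i) :* b₂ := o :* b₁ :- b₁ :* (b₂ :* i))
                     refl 1# b₁ b₂ (b₂ ⁻¹) ⟩
        1# * b₁ - b₁ * (b₂ * b₂ ⁻¹)
          ≡⟨ cong₂ (λ u v → u - b₁ * v) (*-identityˡ b₁) (inverseʳ b₂ (LinIndep⇒≢0 indep)) ⟩
        b₁ - b₁ * 1#
          ≡⟨ cong (λ y → b₁ - y) (*-identityʳ b₁) ⟩
        b₁ - b₁
          ≡⟨ -‿inverseʳ b₁ ⟩
        0# ∎
    ... | 1≡0 ∷ _ = 1≢0 1≡0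

    odd⇒sumFree₂ : Odd n → SumFree q 2 (g q)
    odd⇒sumFree₂ n-odd a (b₁ ∷ b₂ ∷ []) indep affineSum≡0 = J≢0 J≡0
      where
      b₂≢0 = LinIndep⇒≢0 indep
      α = a * b₂ ⁻¹
      β = b₁ * b₂ ⁻¹
      β∉K = LinIndep⇒¬InSub indep
      B≢0 = ¬InSub⇒x^q-x≢0 β∉K
      J≡0 : J α β ≡ 0#
      J≡0 = [ (λ g≡0 → contradiction g≡0 (g≢0 q b₂≢0)) , id ]′
              (x*y≡0⇒x≡0⊎y≡0 (trans (sym (affineSum≡g*J a b₁ b₂≢0)) affineSum≡0))
      J≢0 : J α β ≢ 0#
      J≢0 J≡0 with Any.any? (λ c → ((α + c * β) ^ q) ≟ (α + c * β)) K
      ... | no none = *-≢0 (g≢0 q B≢0) (h≢0 _)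
                        (trans (sym (J-line-misses-K α β∉K (λ c∈K P → none (lose (subElement q c∈K) P)))) J≡0)
      ... | yes some with find some
      ...   | c , c∈K , P = β∉K (odd⇒[x^q]^q≡x⇒InSub n-odd ([x^q-x]^q≡-⇒[x^q]^q≡x (g≡-1⇒^q≡- B≢0 gB≡-1)))
        where
        gB≡-1 : g q (β ^ q - β) ≡ - 1#
        gB≡-1 = -‿injective (x+y≡0⇒x≡-y (trans (sym (J-line-meets-K α β∉K (subElements-InSub q c∈K) P)) J≡0))

    ¬Odd⇒length-K<length-K² : ¬ Odd n → length K < length (subElements (q ℕ.* q))
    ¬Odd⇒length-K<length-K² n-even = ℕ.≤-<-trans |K|≤q (ℕ.<-≤-trans q<q*q q*q≤|K²|)
      where
      n≡[n/2]*2 : n ≡ n / 2 ℕ.* 2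
      n≡[n/2]*2 = n%2≢1⇒n≡[n/2]*2 n n-even
      1≤n/2 : 1 ≤ n / 2
      1≤n/2 with n / 2 | n≡[n/2]*2
      ... | zero  | n≡0 = contradiction n≡0 (ℕ.≢-nonZero⁻¹ n {{ℕ.>-nonZero 1≤n}})
      ... | suc _ | _   = s≤s z≤n
      size≡[q*q]^[n/2] : size ≡ (q ℕ.* q) ℕ.^ (n / 2)
      size≡[q*q]^[n/2] = trans size≡qⁿ (trans (cong (q ℕ.^_) (trans n≡[n/2]*2 (ℕ.*-comm (n / 2) 2)))
                       (trans (sym (ℕ.^-*-assoc q 2 (n / 2))) (cong (λ m → (q ℕ.* m) ℕ.^ (n / 2)) (ℕ.*-identityʳ q))))
      |K|≤q : length K ≤ q
      |K|≤q = Monic-roots≤ (Monic-+ (Monic-^ q) (Degree<-weaken 2≤q Degree<-neg)) K!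
                (All.tabulate λ {c} c∈K → trans (cong (_- c) (subElements-InSub q c∈K)) (-‿inverseʳ c))
      q<q*q : q < q ℕ.* q
      q<q*q = ℕ.m<m*n q q {{ℕ.>-nonZero 1≤q}} 2≤q
      q*q≤|K²| : q ℕ.* q ≤ length (subElements (q ℕ.* q))
      q*q≤|K²| = subElements-length≥ (additive-* q q q-additive q-additive) (ℕ.≤-trans 2≤q (ℕ.<⇒≤ q<q*q))
                                     1≤n/2 size≡[q*q]^[n/2]

    [u^q]^q≡u∧¬InSub⇒¬SumFree₂ : ∀ {u} → (u ^ q) ^ q ≡ u → ¬ InSub q u → ¬ SumFree q 2 (g q)
    [u^q]^q≡u∧¬InSub⇒¬SumFree₂ {u} u^q^q≡u u∉K sumFree₂ = sumFree₂ 0# (u ∷ 1# ∷ []) indep affineSum≡0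
      where
      indep : LinIndep q (u ∷ 1# ∷ [])
      indep (c₁ ∷ c₂ ∷ []) (c₁∈K ∷ c₂∈K ∷ []) lin≡0 = c₁≡0 ∷ c₂≡0 ∷ []
        where
        c₁u+c₂≡0 : c₁ * u + c₂ ≡ 0#
        c₁u+c₂≡0 = trans (cong (c₁ * u +_) (sym (trans (+-identityʳ _) (*-identityʳ c₂)))) lin≡0
        c₁≡0 : c₁ ≡ 0#
        c₁≡0 with c₁ ≟ 0#
        ... | yes c₁≡0 = c₁≡0
        ... | no  c₁≢0 = contradiction (subst (InSub q) u≡ (InSub-* (InSub-⁻¹ c₁≢0 c₁∈K) (InSub-neg c₂∈K))) u∉K
          where
          u≡ : c₁ ⁻¹ * - c₂ ≡ u
          u≡ = trans (cong (c₁ ⁻¹ *_) (sym (x+y≡0⇒x≡-y c₁u+c₂≡0))) (x⁻¹*[x*y]≡y u c₁≢0)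
        c₂≡0 : c₂ ≡ 0#
        c₂≡0 = trans (sym (trans (cong (_+ c₂) (trans (cong (_* u) c₁≡0) (zeroˡ u))) (+-identityˡ c₂))) c₁u+c₂≡0
      B≢0 = ¬InSub⇒x^q-x≢0 u∉K
      0+0*u∈K : InSub q (0# + 0# * u)
      0+0*u∈K = subst (InSub q) (sym (trans (+-identityˡ _) (zeroˡ u))) InSub-0
      affineSum≡0 : affineSum q (g q) 0# (u ∷ 1# ∷ []) ≡ 0#
      affineSum≡0 = begin
        affineSum q (g q) 0# (u ∷ 1# ∷ [])
          ≡⟨ affineSum≡g*J 0# u 1≢0 ⟩
        g q 1# * J (0# * 1# ⁻¹) (u * 1# ⁻¹)
          ≡⟨ cong₂ (λ a b → g q 1# * J a b) (zeroˡ _) (trans (cong (u *_) 1⁻¹≡1) (*-identityʳ u)) ⟩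
        g q 1# * J 0# u
          ≡⟨ cong (g q 1# *_) (J-line-meets-K 0# u∉K InSub-0 0+0*u∈K) ⟩
        g q 1# * (- g q (u ^ q - u) - 1#)
          ≡⟨ cong (λ y → g q 1# * (- y - 1#)) (^q≡-⇒g≡-1 B≢0 ([x^q]^q≡x⇒[x^q-x]^q≡- u^q^q≡u)) ⟩
        g q 1# * (- - 1# - 1#)
          ≡⟨ cong (λ y → g q 1# * (y - 1#)) (-‿involutive 1#) ⟩
        g q 1# * (1# - 1#)
          ≡⟨ cong (g q 1# *_) (-‿inverseʳ 1#) ⟩
        g q 1# * 0#
          ≡⟨ zeroʳ _ ⟩
        0# ∎

    sumFree₂⇒odd : SumFree q 2 (g q) → Odd n
    sumFree₂⇒odd sumFree₂ with n % 2 ℕ.≟ 1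
    ... | yes n-odd = n-odd
    ... | no  n-even with length<⇒∃∈∧∉ _≟_ (subElements! (q ℕ.* q)) (¬Odd⇒length-K<length-K² n-even)
    ...   | u , u∈K² , u∉K = contradiction sumFree₂
            ([u^q]^q≡u∧¬InSub⇒¬SumFree₂ (trans (^-assocʳ u q q) (subElements-InSub (q ℕ.* q) u∈K²))
                                        (u∉K ∘ subElement q))

open import Data.Nat using (_^_)

proposition4p7 : (q : ℕ) → IsPrimePower q → (n : ℕ) → 1 ≤ n →
                 (F : FiniteField) → FiniteField.size F ≡ q ^ n →
                 FiniteField.SumFree F q 1 (FiniteField.g F q)
                 × (2 ≤ n → (FiniteField.SumFree F q 2 (FiniteField.g F q) ⇔ Odd n))
proposition4p7 q (p , m , p-prime , 1≤m , refl) n 1≤n F size≡qⁿ =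
  -- (ii) holds for n = 1 as well.
  sumFree₁ , λ _ → mk⇔ sumFree₂⇒odd odd⇒sumFree₂
  where
  open FiniteFieldTheory F
  q-additive : Additive (p ^ m)
  q-additive = additive-^ p m
    (prime⇒additive p-prime (characteristic p (m ℕ.* n) (trans size≡qⁿ (ℕ.^-*-assoc p m n))))
  2≤q : 2 ≤ p ^ m
  2≤q = ℕ.≤-trans (ℕ.nonTrivial⇒n>1 p {{prime⇒nonTrivial p-prime}})
                  (subst (_≤ p ^ m) (ℕ.*-identityʳ p) (ℕ.^-monoʳ-≤ p {{prime⇒nonZero p-prime}} 1≤m))
  open Subfield q-additive 2≤q 1≤n size≡qⁿ
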